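{- Let $n\ge 2$ and $m$ be integers with $2\le m\le n$. Then the graph $\mathcal{P}^{\mathrm{all}}_n$ admits a $2(m-2)!$-rainbow cycle. In particular, taking $m=n$, there is a balanced transposition Gray code for the permutations of $[n]$, i.e. a cyclic listing of all $n!$ permutations of $[n]$ in which consecutive permutations (including the last and the first) differ by a transposition and every transposition $(i,j)$, $1\le i<j\le n$, is used exactly $2(n-2)!$ times.
   Context: $S_n$ is the set of permutations of $[n]=\{1,\dots,n\}$, written in one-line notation $\pi_1\pi_2\cdots\pi_n$. For distinct $i,j\in[n]$, applying the transposition $(i,j)$ to $\pi$ means interchanging the entries $i$ and $j$ in the one-line notation (e.g. $213\to 231$ under $(1,3)$). $\mathcal{P}^{\mathrm{all}}_n$ is the graph with vertex set $S_n$ in which two permutations are adjacent if they differ by some transposition; the edge is colored by that transposition. An $r$-rainbow cycle is a cyclic sequence $\pi^{(1)},\dots,\pi^{(k)}$ of pairwise distinct permutations ($k\ge 2$) such that consecutive ones, including $\pi^{(k)}$ and $\pi^{(1)}$, differ by a transposition, and each of the $\binom{n}{2}$ transpositions is used in exactly $r$ of these $k$ steps. -}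

module Defs where

open import Data.Nat using (ℕ; suc)
open import Data.Nat.DivMod using (_mod_)
open import Data.Fin using (Fin; toℕ) renaming (_<_ to _<ᶠ_)
open import Data.Fin.Properties using (_≟_)
open import Data.Product using (Σ; _×_; _,_; proj₁)
open import Data.List using (List; length; filter)
open import Data.List.Base using (allFin)
open import Data.Vec.Functional using (Vector)
open import Function.Definitions using (Injective)
open import Relation.Binary.PropositionalEquality using (_≡_)
open import Relation.Nullary using (Dec; yes; no)
open import Relation.Nullary.Decidable using (does; _×-dec_)
open import Data.Bool using (if_then_else_)

-- A permutation of [n] in one-line notation: a word π : Fin n → Fin n
-- (entry π p at position p; value v ∈ Fin n stands for v+1 ∈ [n])
-- whose entries are pairwise distinct.
Perm : ℕ → Set
Perm n = Σ (Vector (Fin n) n) (λ w → Injective _≡_ _≡_ w)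

Transposition : ℕ → Set
Transposition n = Σ (Fin n) (λ i → Σ (Fin n) (λ j → i <ᶠ j))

swapVal : {n : ℕ} → Fin n → Fin n → Fin n → Fin n
swapVal a b x = if does (x ≟ a) then b else (if does (x ≟ b) then a else x)

Step : {n : ℕ} → Transposition n → Perm n → Perm n → Set
Step {n} (i , j , _) π σ = (p : Fin n) → proj₁ σ p ≡ swapVal i j (proj₁ π p)

nextIdx : {k : ℕ} → Fin (suc k) → Fin (suc k)
nextIdx {k} t = suc (toℕ t) mod (suc k)

sameTransposition? : {n : ℕ} (τ τ' : Transposition n) →
  Dec ((proj₁ τ ≡ proj₁ τ') × (proj₁ (Data.Product.proj₂ τ) ≡ proj₁ (Data.Product.proj₂ τ')))
sameTransposition? (i , j , _) (i' , j' , _) = (i ≟ i') ×-dec (j ≟ j')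

countColour : {n k : ℕ} → (Fin k → Transposition n) → Transposition n → ℕ
countColour {k = k} col τ = length (filter (λ t → sameTransposition? (col t) τ) (allFin k))

-- An r-rainbow cycle of length k = suc k' (k ≥ 2): pairwise distinct
-- permutations π⁽⁰⁾ … π⁽ᵏ⁻¹⁾, each consecutive pair (cyclically) related by
-- a transposition (the colour of that step), every transposition used
-- exactly r times.  (The colour of a step between two permutations is
-- uniquely determined by them, so recording it loses nothing.)
record RainbowCycle (n r : ℕ) : Set where
  field
    k'       : ℕ
    len≥2    : 1 Data.Nat.≤ k'
    perm     : Fin (suc k') → Perm n
    distinct : Injective _≡_ _≡_ perm
    colour   : Fin (suc k') → Transposition n
    steps    : (t : Fin (suc k')) → Step (colour t) (perm t) (perm (nextIdx t))
    rainbow  : (τ : Transposition n) → countColour colour τ ≡ r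

-- For n ≤ 4 the cycles are listed explicitly.  A Hamiltonian r-rainbow cycle H on
-- n ≥ 4 symbols yields one on n + 1 symbols: for each u ≤ n, conjugating H by the transposition
-- (u n) gives a cycle through exactly the permutations with value u in position n.  These n + 1
-- blocks are joined into a single cycle by replacing, at every junction j, one edge in block j + 1
-- by the rung (j , j + 1), a Hamiltonian path through blocks 0 … j and the rung again.  The removed
-- colours are the rungs rotated by two places, so every transposition is used (n − 1) r times,
-- and r = 2 (n − 2)! becomes 2 (n − 1)!.
-- For m < n, a 2s-rainbow cycle on n − 1 symbols yields one on n symbols: for every l < n − 1,
-- s of the 2s edges of a colour c avoiding l are replaced by detours (l , n − 1) c (l , n − 1),
-- which contribute the 2s edges of colour (l , n − 1) and visit new permutations with value l in
-- position n − 1.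

module Submission where

open import Defs
open import Data.Nat using (ℕ; suc; _≤_; _*_; _∸_; _!)
open import Data.Product using (_×_; Σ)
open import Relation.Binary.PropositionalEquality using (_≡_)

open import Data.Nat using (zero; _+_; _<_; z≤n; s≤s; _≟_; _<?_; _%_; _≤′_; ≤′-reflexive; ≤′-step)
open import Data.Nat.DivMod using (m%n<n; m<n⇒m%n≡m; n%n≡0; [m+n]%n≡m%n)
open import Data.Nat.Properties
open import Data.Nat.Tactic.RingSolver using (solve-∀)
open import Data.Bool using (true; false)
open import Data.Product using (_,_; proj₁; proj₂; ∃)
import Data.Product as Product
open import Data.Sum using (_⊎_; inj₁; inj₂)
import Data.Sum as Sum
open import Data.Unit using (⊤; tt)
open import Data.Fin using (Fin; toℕ; fromℕ<; zero; suc)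
open import Data.Fin.Properties using (toℕ-injective; toℕ-fromℕ<; toℕ<n)
import Data.Fin.Properties as Fin
open import Data.List using (List; []; _∷_; _++_; [_]; map; length; concat; applyDownFrom; upTo; take; filter; tabulate; lookup)
open import Data.List.Properties
  using (++-assoc; ++-identityʳ; length-++; length-map; map-cong; ≡-dec; filter-accept; filter-reject; take-all)
open import Data.List.Relation.Unary.All using (All; []; _∷_)
import Data.List.Relation.Unary.All as All
import Data.List.Relation.Unary.All.Properties as All
open import Data.List.Relation.Unary.AllPairs using (AllPairs; []; _∷_)
import Data.List.Relation.Unary.AllPairs as AllPairs
import Data.List.Relation.Unary.AllPairs.Properties as AllPairs
open import Data.List.Relation.Binary.Pointwise as Pointwise using (Pointwise; []; _∷_)
open import Data.List.Relation.Binary.Sublist.Propositional using (_⊆_; []; _∷_; _∷ʳ_; minimum)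
import Data.List.Relation.Binary.Sublist.Propositional.Properties as Sublist
open import Data.List.Relation.Ternary.Interleaving using (Interleaving; []; _∷ˡ_; _∷ʳ_)
open import Function using (_∘_; id; _$_; _⇔_; mk⇔; Equivalence)
open import Function.Definitions using (Injective)
open import Relation.Binary.Bundles using (Setoid)
open import Relation.Binary.Definitions using (_Respects_; tri<; tri≈; tri>)
open import Relation.Binary.PropositionalEquality
  using (_≢_; ≢-sym; refl; sym; trans; cong; cong₂; subst; subst₂; _≗_; _→-setoid_; module ≡-Reasoning)
open import Relation.Nullary using (¬_; Dec; yes; no; does; contradiction)
open import Relation.Nullary.Decidable using (True; toWitness; ¬?; _×-dec_; _⊎-dec_; _→-dec_)

module ≗ = Setoid (ℕ →-setoid ℕ)

swap : ℕ → ℕ → ℕ → ℕ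
swap a b x with x ≟ a | x ≟ b
... | yes _ | _     = b
... | no _  | yes _ = a
... | no _  | no _  = x

data SwapCase (a b x : ℕ) : Set where
  at-a  : x ≡ a → SwapCase a b x
  at-b  : x ≢ a → x ≡ b → SwapCase a b x
  other : x ≢ a → x ≢ b → SwapCase a b x

swapCase : ∀ a b x → SwapCase a b x
swapCase a b x with x ≟ a | x ≟ b
... | yes x≡a | _        = at-a x≡a
... | no x≢a  | yes x≡b = at-b x≢a x≡b
... | no x≢a  | no x≢b  = other x≢a x≢b

swap-≡ˡ : ∀ {a b x} → x ≡ a → swap a b x ≡ b
swap-≡ˡ {a} {b} {x} x≡a with x ≟ a | x ≟ b
... | yes _   | _ = refl
... | no x≢a | _ = contradiction x≡a x≢a

swap-≡ʳ : ∀ {a b x} → x ≡ b → swap a b x ≡ a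
swap-≡ʳ {a} {b} {x} x≡b with x ≟ a | x ≟ b
... | yes x≡a | _        = trans (sym x≡b) x≡a
... | no _    | yes _    = refl
... | no _    | no x≢b  = contradiction x≡b x≢b

swap-ˡ : ∀ a b → swap a b a ≡ b
swap-ˡ a b = swap-≡ˡ {a} {b} refl

swap-ʳ : ∀ a b → swap a b b ≡ a
swap-ʳ a b = swap-≡ʳ {a} {b} refl

swap-≢ : ∀ {a b x} → x ≢ a → x ≢ b → swap a b x ≡ x
swap-≢ {a} {b} {x} x≢a x≢b with x ≟ a | x ≟ b
... | yes x≡a | _        = contradiction x≡a x≢a
... | no _    | yes x≡b = contradiction x≡b x≢b
... | no _    | no _     = refl

swap-involutive : ∀ a b x → swap a b (swap a b x) ≡ x
swap-involutive a b x with swapCase a b x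
... | at-a x≡a     = trans (cong (swap a b) (swap-≡ˡ x≡a)) (trans (swap-ʳ a b) (sym x≡a))
... | at-b _ x≡b   = trans (cong (swap a b) (swap-≡ʳ x≡b)) (trans (swap-ˡ a b) (sym x≡b))
... | other x≢a x≢b = trans (cong (swap a b) (swap-≢ x≢a x≢b)) (swap-≢ x≢a x≢b)

swap-injective : ∀ a b → Injective _≡_ _≡_ (swap a b)
swap-injective a b {x} {y} e =
  trans (sym (swap-involutive a b x)) (trans (cong (swap a b) e) (swap-involutive a b y))

swap-comm : ∀ a b x → swap a b x ≡ swap b a x
swap-comm a b x with swapCase a b x
... | at-a x≡a      = trans (swap-≡ˡ x≡a) (sym (swap-≡ʳ x≡a))
... | at-b _ x≡b    = trans (swap-≡ʳ x≡b) (sym (swap-≡ˡ x≡b))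
... | other x≢a x≢b = trans (swap-≢ x≢a x≢b) (sym (swap-≢ x≢b x≢a))

swap-conjugate : ∀ (L : ℕ → ℕ) → Injective _≡_ _≡_ L → ∀ a b x → swap (L a) (L b) (L x) ≡ L (swap a b x)
swap-conjugate L L-inj a b x with swapCase a b x
... | at-a x≡a      = trans (swap-≡ˡ (cong L x≡a)) (sym (cong L (swap-≡ˡ x≡a)))
... | at-b _ x≡b    = trans (swap-≡ʳ (cong L x≡b)) (sym (cong L (swap-≡ʳ x≡b)))
... | other x≢a x≢b = trans (swap-≢ (x≢a ∘ L-inj) (x≢b ∘ L-inj)) (sym (cong L (swap-≢ x≢a x≢b)))

-- swap c d fixes a and b, so conjugating swap a b by it changes nothing.
swap-swap-disjoint : ∀ {a b c d} → a ≢ c → a ≢ d → b ≢ c → b ≢ d →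
                     ∀ x → swap a b (swap c d x) ≡ swap c d (swap a b x)
swap-swap-disjoint {a} {b} {c} {d} a≢c a≢d b≢c b≢d x =
  trans (cong₂ (λ p q → swap p q (swap c d x)) (sym (swap-≢ a≢c a≢d)) (sym (swap-≢ b≢c b≢d)))
        (swap-conjugate (swap c d) (swap-injective c d) a b x)

swap-< : ∀ {k a b x} → a < k → b < k → x < k → swap a b x < k
swap-< {k} {a} {b} {x} a<k b<k x<k with swapCase a b x
... | at-a x≡a      = subst (_< k) (sym (swap-≡ˡ x≡a)) b<k
... | at-b _ x≡b    = subst (_< k) (sym (swap-≡ʳ x≡b)) a<k
... | other x≢a x≢b = subst (_< k) (sym (swap-≢ x≢a x≢b)) x<k

Pair : Set
Pair = ℕ × ℕ

⟦_⟧ : Pair → ℕ → ℕ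
⟦ a , b ⟧ = swap a b

⟦⟧-involutive : ∀ c x → ⟦ c ⟧ (⟦ c ⟧ x) ≡ x
⟦⟧-involutive (a , b) = swap-involutive a b

⟦⟧-injective : ∀ c → Injective _≡_ _≡_ ⟦ c ⟧
⟦⟧-injective (a , b) = swap-injective a b

_∼_ : Pair → Pair → Set
(a , b) ∼ (c , d) = (a ≡ c × b ≡ d) ⊎ (a ≡ d × b ≡ c)

_∼?_ : ∀ γ c → Dec (γ ∼ c)
(a , b) ∼? (c , d) = ((a ≟ c) ×-dec (b ≟ d)) ⊎-dec ((a ≟ d) ×-dec (b ≟ c))

∼-refl : ∀ {γ} → γ ∼ γ
∼-refl = inj₁ (refl , refl)

∼-flip : ∀ {a b} → (a , b) ∼ (b , a)
∼-flip = inj₂ (refl , refl)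

∼-sym : ∀ {γ c} → γ ∼ c → c ∼ γ
∼-sym {_ , _} {_ , _} (inj₁ (refl , refl)) = ∼-refl
∼-sym {_ , _} {_ , _} (inj₂ (refl , refl)) = ∼-flip

∼-trans : ∀ {γ δ c} → γ ∼ δ → δ ∼ c → γ ∼ c
∼-trans {_ , _} {_ , _} {_ , _} (inj₁ (refl , refl)) δ∼c                  = δ∼c
∼-trans {_ , _} {_ , _} {_ , _} (inj₂ (refl , refl)) (inj₁ (refl , refl)) = ∼-flip
∼-trans {_ , _} {_ , _} {_ , _} (inj₂ (refl , refl)) (inj₂ (refl , refl)) = ∼-refl

⟦⟧-resp-∼ : ∀ {γ c} → γ ∼ c → ⟦ γ ⟧ ≗ ⟦ c ⟧
⟦⟧-resp-∼ {_ , _} {_ , _} (inj₁ (refl , refl)) x = refl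
⟦⟧-resp-∼ {a , b} {_ , _} (inj₂ (refl , refl)) x = swap-comm a b x

count : Pair → List Pair → ℕ
count γ [] = 0
count γ (c ∷ w) with γ ∼? c
... | yes _ = suc (count γ w)
... | no _  = count γ w

count-++ : ∀ γ u v → count γ (u ++ v) ≡ count γ u + count γ v
count-++ γ []      v = refl
count-++ γ (c ∷ u) v with γ ∼? c
... | yes _ = cong suc (count-++ γ u v)
... | no _  = count-++ γ u v

count-∷ : ∀ γ c w → count γ (c ∷ w) ≡ count γ [ c ] + count γ w
count-∷ γ c w = count-++ γ [ c ] w

count-resp-∼ : ∀ {γ δ} w → γ ∼ δ → count γ w ≡ count δ w
count-resp-∼ []      γ∼δ = refl
count-resp-∼ {γ} {δ} (c ∷ w) γ∼δ with γ ∼? c | δ ∼? c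
... | yes _   | yes _   = cong suc (count-resp-∼ w γ∼δ)
... | no _    | no _    = count-resp-∼ w γ∼δ
... | yes γ∼c | no δ≁c  = contradiction (∼-trans (∼-sym γ∼δ) γ∼c) δ≁c
... | no γ≁c  | yes δ∼c = contradiction (∼-trans γ∼δ δ∼c) γ≁c

count-[]-resp-∼ : ∀ γ {c c′} → c ∼ c′ → count γ [ c ] ≡ count γ [ c′ ]
count-[]-resp-∼ γ {c} {c′} c∼c′ with γ ∼? c | γ ∼? c′
... | yes _   | yes _    = refl
... | no _    | no _     = refl
... | yes γ∼c | no γ≁c′ = contradiction (∼-trans γ∼c c∼c′) γ≁c′
... | no γ≁c  | yes γ∼c′ = contradiction (∼-trans γ∼c′ (∼-sym c∼c′)) γ≁c

count-rotate : ∀ γ E c F → count γ (F ++ E) + count γ [ c ] ≡ count γ (E ++ c ∷ F)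
count-rotate γ E c F = begin
  count γ (F ++ E) + count γ [ c ]              ≡⟨ cong (_+ count γ [ c ]) (count-++ γ F E) ⟩
  count γ F + count γ E + count γ [ c ]         ≡⟨ rearrange (count γ F) (count γ E) (count γ [ c ]) ⟩
  count γ E + (count γ [ c ] + count γ F)       ≡⟨ cong (count γ E +_) (count-∷ γ c F) ⟨
  count γ E + count γ (c ∷ F)                   ≡⟨ count-++ γ E (c ∷ F) ⟨
  count γ (E ++ c ∷ F)                          ∎
  where
  open ≡-Reasoning
  rearrange : ∀ f e x → f + e + x ≡ e + (x + f)
  rearrange = solve-∀

count-≡0 : ∀ {γ} w → All (λ c → ¬ γ ∼ c) w → count γ w ≡ 0
count-≡0 {γ} []      []           = refl
count-≡0 {γ} (c ∷ w) (γ≁c ∷ γ≁w) with γ ∼? c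
... | yes γ∼c = contradiction γ∼c γ≁c
... | no _    = count-≡0 w γ≁w

occurrence : ∀ γ w → 1 ≤ count γ w → ∃ λ E → ∃ λ c → ∃ λ F → w ≡ E ++ c ∷ F × γ ∼ c
occurrence γ (c ∷ w) 1≤count with γ ∼? c
... | yes γ∼c = [] , c , w , refl , γ∼c
... | no _ with occurrence γ w 1≤count
...   | E , c′ , F , refl , γ∼c′ = c ∷ E , c′ , F , refl , γ∼c′

Colour : ℕ → Pair → Set
Colour k (a , b) = a < k × b < k × a ≢ b

Colour-suc : ∀ {k c} → Colour k c → Colour (suc k) c
Colour-suc (a<k , b<k , a≢b) = m<n⇒m<1+n a<k , m<n⇒m<1+n b<k , a≢b

Avoids : ℕ → Pair → Set
Avoids j (a , b) = a ≢ j × b ≢ j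

Colour⇒Avoids : ∀ {k c} → Colour k c → Avoids k c
Colour⇒Avoids (a<k , b<k , _) = <⇒≢ a<k , <⇒≢ b<k

Avoids-resp-∼ : ∀ {j γ c} → γ ∼ c → Avoids j γ → Avoids j c
Avoids-resp-∼ {_} {_ , _} {_ , _} (inj₁ (refl , refl)) avoids         = avoids
Avoids-resp-∼ {_} {_ , _} {_ , _} (inj₂ (refl , refl)) (a≢j , b≢j) = b≢j , a≢j

⟦⟧-fixes : ∀ {j} c → Avoids j c → ⟦ c ⟧ j ≡ j
⟦⟧-fixes (a , b) (a≢j , b≢j) = swap-≢ (a≢j ∘ sym) (b≢j ∘ sym)

count-≡0-Avoids : ∀ {j γ} w → All (Avoids j) w → ¬ Avoids j γ → count γ w ≡ 0
count-≡0-Avoids w avoids γ-touches =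
  count-≡0 w (All.map (λ c-avoids γ∼c → γ-touches (Avoids-resp-∼ (∼-sym γ∼c) c-avoids)) avoids)

count-[]-yes : ∀ {γ c} → γ ∼ c → count γ [ c ] ≡ 1
count-[]-yes {γ} {c} γ∼c with γ ∼? c
... | yes _   = refl
... | no γ≁c = contradiction γ∼c γ≁c

count-[]-no : ∀ {γ c} → ¬ γ ∼ c → count γ [ c ] ≡ 0
count-[]-no γ≁c = count-≡0 _ (γ≁c ∷ [])

count-≤-length : ∀ γ w → count γ w ≤ length w
count-≤-length γ []      = z≤n
count-≤-length γ (c ∷ w) with γ ∼? c
... | yes _ = s≤s (count-≤-length γ w)
... | no _  = m≤n⇒m≤1+n (count-≤-length γ w)

≁-touching : ∀ {j γ} i → Avoids j γ → ¬ γ ∼ (i , j)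
≁-touching i γ-avoids γ∼ij = proj₂ (Avoids-resp-∼ γ∼ij γ-avoids) refl

-- A permutation of [n] is its one-line word, as the function from positions to values, extended
-- by the identity beyond n.  An edge of colour c interchanges two entries: it post-composes ⟦ c ⟧.
Fun : Set
Fun = ℕ → ℕ

walk : Fun → List Pair → Fun
walk f []      = f
walk f (c ∷ w) = walk (⟦ c ⟧ ∘ f) w

visits : Fun → List Pair → List Fun
visits f []      = []
visits f (c ∷ w) = f ∷ visits (⟦ c ⟧ ∘ f) w

visits⁺ : Fun → List Pair → List Fun
visits⁺ f w = visits f w ++ [ walk f w ]

walk-++ : ∀ f u v → walk f (u ++ v) ≡ walk (walk f u) v
walk-++ f []      v = refl
walk-++ f (c ∷ u) v = walk-++ (⟦ c ⟧ ∘ f) u v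

visits-++ : ∀ f u v → visits f (u ++ v) ≡ visits f u ++ visits (walk f u) v
visits-++ f []      v = refl
visits-++ f (c ∷ u) v = cong (f ∷_) (visits-++ (⟦ c ⟧ ∘ f) u v)

walk-∘ʳ : ∀ f g w → walk (f ∘ g) w ≡ walk f w ∘ g
walk-∘ʳ f g []      = refl
walk-∘ʳ f g (c ∷ w) = walk-∘ʳ (⟦ c ⟧ ∘ f) g w

visits-∘ʳ : ∀ f g w → visits (f ∘ g) w ≡ map (_∘ g) (visits f w)
visits-∘ʳ f g []      = refl
visits-∘ʳ f g (c ∷ w) = cong ((f ∘ g) ∷_) (visits-∘ʳ (⟦ c ⟧ ∘ f) g w)

infix 4 _≋_ _≉_

_≋_ : List Fun → List Fun → Set
_≋_ = Pointwise _≗_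

≋-refl : ∀ {xs} → xs ≋ xs
≋-refl = Pointwise.refl ≗.refl

≋-sym : ∀ {xs ys} → xs ≋ ys → ys ≋ xs
≋-sym = Pointwise.symmetric ≗.sym

⟦⟧∘-cong : ∀ c {f g : Fun} → f ≗ g → ⟦ c ⟧ ∘ f ≗ ⟦ c ⟧ ∘ g
⟦⟧∘-cong c f≗g x = cong ⟦ c ⟧ (f≗g x)

walk-cong : ∀ {f g : Fun} w → f ≗ g → walk f w ≗ walk g w
walk-cong []      f≗g = f≗g
walk-cong (c ∷ w) f≗g = walk-cong w (⟦⟧∘-cong c f≗g)

visits-cong : ∀ {f g : Fun} w → f ≗ g → visits f w ≋ visits g w
visits-cong []      f≗g = []
visits-cong (c ∷ w) f≗g = f≗g ∷ visits-cong w (⟦⟧∘-cong c f≗g)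

walk-injective : ∀ {f} w → Injective _≡_ _≡_ f → Injective _≡_ _≡_ (walk f w)
walk-injective []      f-inj = f-inj
walk-injective (c ∷ w) f-inj = walk-injective w (f-inj ∘ ⟦⟧-injective c)

walk-keeps : ∀ {j} q f w → All (Avoids j) w → f q ≡ j → walk f w q ≡ j
walk-keeps q f []      []               fq≡j = fq≡j
walk-keeps q f (c ∷ w) (c-avoids ∷ avoids) fq≡j =
  walk-keeps q (⟦ c ⟧ ∘ f) w avoids (trans (cong ⟦ c ⟧ fq≡j) (⟦⟧-fixes c c-avoids))

visits-keep : ∀ {j} q f w → All (Avoids j) w → f q ≡ j → All (λ V → V q ≡ j) (visits f w)
visits-keep q f []      []               fq≡j = []
visits-keep q f (c ∷ w) (c-avoids ∷ avoids) fq≡j =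
  fq≡j ∷ visits-keep q (⟦ c ⟧ ∘ f) w avoids (trans (cong ⟦ c ⟧ fq≡j) (⟦⟧-fixes c c-avoids))

visits⁺-keep : ∀ {j} q f w → All (Avoids j) w → f q ≡ j → All (λ V → V q ≡ j) (visits⁺ f w)
visits⁺-keep q f w avoids fq≡j = All.++⁺ (visits-keep q f w avoids fq≡j) (walk-keeps q f w avoids fq≡j ∷ [])

Onto : Fun → Set
Onto f = ∀ y → ∃ λ x → f x ≡ y

⟦⟧∘-onto : ∀ c {f} → Onto f → Onto (⟦ c ⟧ ∘ f)
⟦⟧∘-onto c f-onto y with f-onto (⟦ c ⟧ y)
... | x , fx≡cy = x , trans (cong ⟦ c ⟧ fx≡cy) (⟦⟧-involutive c y)

id-onto : Onto id
id-onto y = y , refl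

walk-onto : ∀ {f} w → Onto f → Onto (walk f w)
walk-onto []      f-onto = f-onto
walk-onto (c ∷ w) f-onto = walk-onto w (⟦⟧∘-onto c f-onto)

_≉_ : Fun → Fun → Set
f ≉ g = ¬ (f ≗ g)

≉-sym : ∀ {f g} → f ≉ g → g ≉ f
≉-sym f≉g g≗f = f≉g (≗.sym g≗f)

≉-resp-≗ : ∀ {f g h} → f ≗ g → f ≉ h → g ≉ h
≉-resp-≗ f≗g f≉h g≗h = f≉h (≗.trans f≗g g≗h)

≉-resp-≗ʳ : ∀ {f g h} → g ≗ h → f ≉ g → f ≉ h
≉-resp-≗ʳ g≗h f≉g f≗h = f≉g (≗.trans f≗h (≗.sym g≗h))

Distinct : List Fun → Set
Distinct = AllPairs _≉_

All-resp-≋ : ∀ {P : Fun → Set} → P Respects _≗_ → ∀ {xs ys} → xs ≋ ys → All P xs → All P ys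
All-resp-≋ resp []           []         = []
All-resp-≋ resp (x≗y ∷ xs≋ys) (px ∷ pxs) = resp x≗y px ∷ All-resp-≋ resp xs≋ys pxs

Distinct-resp-≋ : ∀ {xs ys} → xs ≋ ys → Distinct xs → Distinct ys
Distinct-resp-≋ []            []                = []
Distinct-resp-≋ (x≗y ∷ xs≋ys) (x≉xs ∷ distinct) =
  All-resp-≋ ≉-resp-≗ʳ xs≋ys (All.map (≉-resp-≗ x≗y) x≉xs) ∷ Distinct-resp-≋ xs≋ys distinct

Distinct-∘ʳ : ∀ {h} → Onto h → ∀ {xs} → Distinct xs → Distinct (map (_∘ h) xs)
Distinct-∘ʳ {h} h-onto distinct = AllPairs.map⁺ (AllPairs.map ≉-∘ʳ distinct)
  where
  ≉-∘ʳ : ∀ {f g} → f ≉ g → f ∘ h ≉ g ∘ h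
  ≉-∘ʳ {f} {g} f≉g fh≗gh = f≉g λ y → let (x , hx≡y) = h-onto y in subst (λ z → f z ≡ g z) hx≡y (fh≗gh x)

Distinct-∘ˡ : ∀ {L} → Injective _≡_ _≡_ L → ∀ {xs} → Distinct xs → Distinct (map (L ∘_) xs)
Distinct-∘ˡ L-inj distinct = AllPairs.map⁺ (AllPairs.map (λ f≉g Lf≗Lg → f≉g (L-inj ∘ Lf≗Lg)) distinct)

Apart : List Fun → List Fun → Set
Apart xs ys = All (λ x → All (x ≉_) ys) xs

Apart-sym : ∀ {xs ys} → Apart xs ys → Apart ys xs
Apart-sym apart = All.map (All.map ≉-sym) (All.All-swap apart)

Apart-++ʳ : ∀ {xs} ys {zs} → Apart xs (ys ++ zs) → Apart xs ys × Apart xs zs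
Apart-++ʳ ys apart = All.map (All.++⁻ˡ ys) apart , All.map (All.++⁻ʳ ys) apart

Apart-++⁺ʳ : ∀ {xs ys zs} → Apart xs ys → Apart xs zs → Apart xs (ys ++ zs)
Apart-++⁺ʳ apart₁ apart₂ = All.zipWith (λ (p , q) → All.++⁺ p q) (apart₁ , apart₂)

Distinct-++⁻ : ∀ xs {ys} → Distinct (xs ++ ys) → Distinct xs × Distinct ys × Apart xs ys
Distinct-++⁻ []       distinct = [] , distinct , []
Distinct-++⁻ (x ∷ xs) (x≉xsys ∷ distinct) with Distinct-++⁻ xs distinct
... | dxs , dys , apart = All.++⁻ˡ xs x≉xsys ∷ dxs , dys , All.++⁻ʳ xs x≉xsys ∷ apart

Distinct-++-comm : ∀ xs {ys} → Distinct (xs ++ ys) → Distinct (ys ++ xs)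
Distinct-++-comm xs distinct with Distinct-++⁻ xs distinct
... | dxs , dys , apart = AllPairs.++⁺ dys dxs (Apart-sym apart)

Distinct-insert : ∀ xs {ys zs} → Distinct (xs ++ zs) → Distinct ys → Apart ys (xs ++ zs) →
                  Distinct (xs ++ ys ++ zs)
Distinct-insert xs {ys} {zs} distinct dys apart with Distinct-++⁻ xs distinct | Apart-++ʳ xs apart
... | dxs , dzs , xs-zs | ys-xs , ys-zs =
  AllPairs.++⁺ dxs (AllPairs.++⁺ dys dzs ys-zs) (Apart-++⁺ʳ (Apart-sym ys-xs) xs-zs)

Apart-separated : ∀ {P Q : Fun → Set} → (∀ {f} → P f → ¬ Q f) → P Respects _≗_ →
                  ∀ {xs ys} → All P xs → All Q ys → Apart xs ys
Apart-separated P⇒¬Q P-resp pxs qys = All.map (λ px → All.map (λ qy x≗y → P⇒¬Q (P-resp x≗y px) qy) qys) pxs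

Distinct-⊆ : ∀ {xs ys} → xs ⊆ ys → Distinct ys → Distinct xs
Distinct-⊆ []         _                 = []
Distinct-⊆ (y ∷ʳ xs⊆ys) (_ ∷ distinct)    = Distinct-⊆ xs⊆ys distinct
Distinct-⊆ (refl ∷ xs⊆ys) (y≉ys ∷ distinct) = Sublist.All-resp-⊆ xs⊆ys y≉ys ∷ Distinct-⊆ xs⊆ys distinct

Interleaved : List Fun → List Fun → List Fun → Set
Interleaved = Interleaving _≗_ _≗_

All-interleaved : ∀ {P : Fun → Set} → P Respects _≗_ →
                  ∀ {xs ys zs} → Interleaved xs ys zs → All P xs → All P ys → All P zs
All-interleaved resp []             []         []         = []
All-interleaved resp (x≗z ∷ˡ inter) (px ∷ pxs) pys        = resp x≗z px ∷ All-interleaved resp inter pxs pys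
All-interleaved resp (y≗z ∷ʳ inter) pxs        (py ∷ pys) = resp y≗z py ∷ All-interleaved resp inter pxs pys

Distinct-interleaved : ∀ {xs ys zs} → Interleaved xs ys zs → Distinct xs → Distinct ys → Apart xs ys → Distinct zs
Distinct-interleaved []             []             []             []                 = []
Distinct-interleaved (x≗z ∷ˡ inter) (x≉xs ∷ dxs)   dys            (x≉ys ∷ apart)     =
  All-interleaved ≉-resp-≗ʳ inter (All.map (≉-resp-≗ x≗z) x≉xs) (All.map (≉-resp-≗ x≗z) x≉ys)
  ∷ Distinct-interleaved inter dxs dys apart
Distinct-interleaved (y≗z ∷ʳ inter) dxs            (y≉ys ∷ dys)   apart              =
  All-interleaved ≉-resp-≗ʳ inter (All.map (λ x≉yys → ≉-resp-≗ y≗z (≉-sym (All.head x≉yys))) apart)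
                                  (All.map (≉-resp-≗ y≗z) y≉ys)
  ∷ Distinct-interleaved inter dxs dys (All.map All.tail apart)

walk-cancel : ∀ {f g} w → walk f w ≗ walk g w → f ≗ g
walk-cancel {f} {g} w fw≗gw x = walk-injective w id (trans (sym (cong (_$ x) (walk-∘ʳ id f w)))
                                                    (trans (fw≗gw x) (cong (_$ x) (walk-∘ʳ id g w))))

-- Cycles are read from every start, since gluing enters a block at an arbitrary vertex.
Cycle : List Pair → Set
Cycle w = ∀ z → Onto z → walk z w ≗ z × Distinct (visits z w)

Cycle-from-id : ∀ {w} → walk id w ≗ id → Distinct (visits id w) → Cycle w
Cycle-from-id {w} closed distinct z z-onto =
  (λ x → trans (cong (_$ x) (walk-∘ʳ id z w)) (closed (z x))) ,
  subst Distinct (sym (visits-∘ʳ id z w)) (Distinct-∘ʳ z-onto distinct)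

Cycle-rotate : ∀ u v → Cycle (u ++ v) → Cycle (v ++ u)
Cycle-rotate u v cycle z z-onto = closed , distinct
  where
  z₀ = walk z v
  cycle₀ = cycle z₀ (walk-onto v z-onto)
  back : walk z₀ u ≗ z
  back = walk-cancel v (λ x → trans (sym (cong (_$ x) (walk-++ z₀ u v))) (proj₁ cycle₀ x))
  closed : walk z (v ++ u) ≗ z
  closed x = trans (cong (_$ x) (walk-++ z v u)) (back x)
  distinct : Distinct (visits z (v ++ u))
  distinct = subst Distinct (sym (visits-++ z v u))
    (Distinct-++-comm (visits z₀ u)
      (Distinct-resp-≋ (Pointwise.++⁺ ≋-refl (visits-cong v back))
        (subst Distinct (visits-++ z₀ u v) (proj₂ cycle₀))))

Path : Pair → List Pair → Set
Path c p = ∀ z → Onto z → walk z p ≗ ⟦ c ⟧ ∘ z × Distinct (visits⁺ z p)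

Cycle⇒Path : ∀ p c → Cycle (p ++ [ c ]) → Path c p
Cycle⇒Path p c cycle z z-onto = ends , subst Distinct (visits-++ z p [ c ]) (proj₂ (cycle z z-onto))
  where
  ends : walk z p ≗ ⟦ c ⟧ ∘ z
  ends x = trans (sym (⟦⟧-involutive c _))
                 (cong ⟦ c ⟧ (trans (sym (cong (_$ x) (walk-++ z p [ c ]))) (proj₁ (cycle z z-onto) x)))

conjugate : (ℕ → ℕ) → List Pair → List Pair
conjugate L = map (Product.map L L)

module _ {L : ℕ → ℕ} (L-invol : ∀ x → L (L x) ≡ x) where

  ∼-conjugateʳ : ∀ {γ c} → γ ∼ Product.map L L c → Product.map L L γ ∼ c
  ∼-conjugateʳ {_ , _} {p , q} (inj₁ (refl , refl)) = inj₁ (L-invol p , L-invol q)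
  ∼-conjugateʳ {_ , _} {p , q} (inj₂ (refl , refl)) = inj₂ (L-invol q , L-invol p)

  ∼-conjugateˡ : ∀ {γ c} → Product.map L L γ ∼ c → γ ∼ Product.map L L c
  ∼-conjugateˡ {a , b} {_ , _} (inj₁ (refl , refl)) = inj₁ (sym (L-invol a) , sym (L-invol b))
  ∼-conjugateˡ {a , b} {_ , _} (inj₂ (refl , refl)) = inj₂ (sym (L-invol a) , sym (L-invol b))

  count-conjugate : ∀ γ w → count γ (conjugate L w) ≡ count (Product.map L L γ) w
  count-conjugate γ []      = refl
  count-conjugate γ (c ∷ w) with γ ∼? Product.map L L c | Product.map L L γ ∼? c
  ... | yes _  | yes _  = cong suc (count-conjugate γ w)
  ... | no _   | no _   = count-conjugate γ w
  ... | yes e  | no ¬e = contradiction (∼-conjugateʳ e) ¬e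
  ... | no ¬e | yes e  = contradiction (∼-conjugateˡ e) ¬e

module _ (L : ℕ → ℕ) (L-inj : Injective _≡_ _≡_ L) where

  private
    step-conjugate : ∀ a b {G F : Fun} → G ≗ L ∘ F → swap (L a) (L b) ∘ G ≗ L ∘ swap a b ∘ F
    step-conjugate a b {G} {F} G≗LF x = trans (cong (swap (L a) (L b)) (G≗LF x)) (swap-conjugate L L-inj a b (F x))

  walk-conjugate : ∀ {G F : Fun} w → G ≗ L ∘ F → walk G (conjugate L w) ≗ L ∘ walk F w
  walk-conjugate []            G≗LF = G≗LF
  walk-conjugate ((a , b) ∷ w) G≗LF = walk-conjugate w (step-conjugate a b G≗LF)

  visits-conjugate : ∀ {G F : Fun} w → G ≗ L ∘ F → visits G (conjugate L w) ≋ map (L ∘_) (visits F w)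
  visits-conjugate []            G≗LF = []
  visits-conjugate ((a , b) ∷ w) G≗LF = G≗LF ∷ visits-conjugate w (step-conjugate a b G≗LF)

Cycle-conjugate : ∀ {L} → (∀ x → L (L x) ≡ x) → ∀ {w} → Cycle w → Cycle (conjugate L w)
Cycle-conjugate {L} L-invol {w} cycle z z-onto = closed , distinct
  where
  L-inj : Injective _≡_ _≡_ L
  L-inj {x} {y} Lx≡Ly = trans (sym (L-invol x)) (trans (cong L Lx≡Ly) (L-invol y))
  Lz-onto : Onto (L ∘ z)
  Lz-onto y with z-onto (L y)
  ... | x , zx≡Ly = x , trans (cong L zx≡Ly) (L-invol y)
  z≗LLz : z ≗ L ∘ (L ∘ z)
  z≗LLz x = sym (L-invol (z x))
  closed : walk z (conjugate L w) ≗ z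
  closed x = trans (walk-conjugate L L-inj w z≗LLz x) (trans (cong L (proj₁ (cycle (L ∘ z) Lz-onto) x)) (L-invol (z x)))
  distinct : Distinct (visits z (conjugate L w))
  distinct = Distinct-resp-≋ (≋-sym (visits-conjugate L L-inj w z≗LLz)) (Distinct-∘ˡ L-inj (proj₂ (cycle (L ∘ z) Lz-onto)))

module Splice (y : Fun) (A : List Pair) (σ : Pair) (Q : List Pair) (c : Pair) (B : List Pair)
              (Q-path : walk (⟦ σ ⟧ ∘ walk y A) Q ≗ ⟦ c ⟧ ∘ ⟦ σ ⟧ ∘ walk y A)
              (commute : ∀ x → ⟦ σ ⟧ (⟦ c ⟧ x) ≡ ⟦ c ⟧ (⟦ σ ⟧ x)) where

  private
    a = walk y A
    a′ = ⟦ σ ⟧ ∘ a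

    rejoin : ⟦ σ ⟧ ∘ walk a′ Q ≗ ⟦ c ⟧ ∘ a
    rejoin x = trans (cong ⟦ σ ⟧ (Q-path x)) (trans (commute (⟦ σ ⟧ (a x))) (cong ⟦ c ⟧ (⟦⟧-involutive σ (a x))))

  splice-walk : walk y (A ++ σ ∷ Q ++ σ ∷ B) ≗ walk y (A ++ c ∷ B)
  splice-walk x = begin
    walk y (A ++ σ ∷ Q ++ σ ∷ B) x   ≡⟨ cong (_$ x) (walk-++ y A (σ ∷ Q ++ σ ∷ B)) ⟩
    walk a′ (Q ++ σ ∷ B) x           ≡⟨ cong (_$ x) (walk-++ a′ Q (σ ∷ B)) ⟩
    walk (⟦ σ ⟧ ∘ walk a′ Q) B x     ≡⟨ walk-cong B rejoin x ⟩
    walk (⟦ c ⟧ ∘ a) B x             ≡⟨ cong (_$ x) (walk-++ y A (c ∷ B)) ⟨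
    walk y (A ++ c ∷ B) x            ∎
    where open ≡-Reasoning

  splice-visits : visits y (A ++ σ ∷ Q ++ σ ∷ B) ≋ visits y A ++ a ∷ visits⁺ a′ Q ++ visits (⟦ c ⟧ ∘ a) B
  splice-visits rewrite visits-++ y A (σ ∷ Q ++ σ ∷ B) | visits-++ a′ Q (σ ∷ B)
                      | ++-assoc (visits a′ Q) [ walk a′ Q ] (visits (⟦ c ⟧ ∘ a) B) =
    Pointwise.++⁺ ≋-refl (≗.refl ∷ Pointwise.++⁺ ≋-refl (≗.refl ∷ visits-cong B rejoin))

Cycle-open : ∀ E c F → Cycle (E ++ c ∷ F) → Path c (F ++ E)
Cycle-open E c F cycle = Cycle⇒Path (F ++ E) c (subst Cycle (sym (++-assoc F E [ c ]))
  (Cycle-rotate (E ++ [ c ]) F (subst Cycle (sym (++-assoc E [ c ] F)) cycle)))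

Path-resp-∼ : ∀ {c c′ p} → c ∼ c′ → Path c p → Path c′ p
Path-resp-∼ c∼c′ path z z-onto =
  (λ x → trans (proj₁ (path z z-onto) x) (⟦⟧-resp-∼ c∼c′ (z x))) , proj₂ (path z z-onto)

All-rotate : ∀ {P : Pair → Set} E c F → All P (E ++ c ∷ F) → All P (F ++ E) × P c
All-rotate E c F all with All.++⁻ E all
... | pE , pc ∷ pF = All.++⁺ pF pE , pc

length-rotate : ∀ E (c : Pair) F → length (F ++ E) + 1 ≡ length (E ++ c ∷ F)
length-rotate E c F = begin
  length (F ++ E) + 1            ≡⟨ cong (_+ 1) (length-++ F) ⟩
  length F + length E + 1        ≡⟨ rearrange (length F) (length E) ⟩
  length E + length (c ∷ F)      ≡⟨ length-++ E ⟨
  length (E ++ c ∷ F)            ∎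
  where
  open ≡-Reasoning
  rearrange : ∀ f e → f + e + 1 ≡ e + suc f
  rearrange = solve-∀

≤-resp-≗ : ∀ p {j} → (λ (V : Fun) → V p ≤ j) Respects _≗_
≤-resp-≗ p {j} V≗W = subst (_≤ j) (V≗W p)

Distinct-insert-below : ∀ p {j} X {Y Z} → Distinct (X ++ Z) → All (λ V → V p ≡ suc j) (X ++ Z) →
                        Distinct Y → All (λ V → V p ≤ j) Y →
                        Distinct (X ++ Y ++ Z) × All (λ V → V p ≤ suc j) (X ++ Y ++ Z)
Distinct-insert-below p {j} X {Y} {Z} distinct-XZ at-XZ distinct-Y below-Y =
  Distinct-insert X distinct-XZ distinct-Y apart ,
  All.++⁺ (All.map ≤-reflexive at-X) (All.++⁺ (All.map m≤n⇒m≤1+n below-Y) (All.map ≤-reflexive at-Z))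
  where
  below⇒≢ : ∀ {V : Fun} → V p ≤ j → V p ≢ suc j
  below⇒≢ Vp≤j Vp≡1+j = 1+n≰n (subst (_≤ j) Vp≡1+j Vp≤j)
  apart = Apart-separated {P = λ V → V p ≤ j} {Q = λ V → V p ≡ suc j} (λ {V} → below⇒≢ {V}) (≤-resp-≗ p) below-Y at-XZ
  at-X = All.++⁻ˡ X at-XZ
  at-Z = All.++⁻ʳ X at-XZ

record RainbowWord (n r : ℕ) : Set where
  field
    word     : List Pair
    colours  : All (Colour n) word
    closed   : walk id word ≗ id
    distinct : Distinct (visits id word)
    rainbow  : ∀ γ → Colour n γ → count γ word ≡ r

  cycle : Cycle word
  cycle = Cycle-from-id closed distinct

module Gluing (n : ℕ) {r : ℕ} (1≤r : 1 ≤ r) (H : RainbowWord (4 + n) r) where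

  module H = RainbowWord H

  N : ℕ
  N = 4 + n

  -- Read from a vertex with value u in position N, block u stays among such vertices.
  block : ℕ → List Pair
  block u = conjugate (swap u N) H.word

  blocks : ℕ → List Pair
  blocks m = concat (applyDownFrom block m)

  swap-below : ∀ {u a} → u < suc N → a < suc N → a ≢ u → swap u N a < N
  swap-below {u} {a} u<k a<k a≢u with swapCase u N a
  ... | at-a a≡u      = contradiction a≡u a≢u
  ... | at-b _ a≡N    = subst (_< N) (sym (swap-≡ʳ a≡N)) (≤∧≢⇒< (≤-pred u<k) (λ u≡N → a≢u (trans a≡N (sym u≡N))))
  ... | other _ a≢N   = subst (_< N) (sym (swap-≢ a≢u a≢N)) (≤∧≢⇒< (≤-pred a<k) a≢N)

  block-colours : ∀ {u} → u < suc N → All (Colour (suc N)) (block u)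
  block-colours {u} u<k = All.map⁺ (All.map colour H.colours)
    where
    colour : ∀ {c} → Colour N c → Colour (suc N) (Product.map (swap u N) (swap u N) c)
    colour (a<N , b<N , a≢b) =
      swap-< u<k (n<1+n N) (m<n⇒m<1+n a<N) , swap-< u<k (n<1+n N) (m<n⇒m<1+n b<N) , a≢b ∘ swap-injective u N

  block-avoids : ∀ u → All (Avoids u) (block u)
  block-avoids u = All.map⁺ (All.map (λ (a<N , b<N , _) → moved a<N , moved b<N) H.colours)
    where
    moved : ∀ {a} → a < N → swap u N a ≢ u
    moved {a} a<N e = <⇒≢ a<N (trans (sym (swap-involutive u N a)) (trans (cong (swap u N) e) (swap-ˡ u N)))

  block-cycle : ∀ u → Cycle (block u)
  block-cycle u = Cycle-conjugate (swap-involutive u N) H.cycle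

  block-length : ∀ u → length (block u) ≡ length H.word
  block-length u = length-map _ H.word

  count-block : ∀ {u γ} → u < suc N → Colour (suc N) γ → Avoids u γ → count γ (block u) ≡ r
  count-block {u} {a , b} u<k (a<k , b<k , a≢b) (a≢u , b≢u) =
    trans (count-conjugate (swap-involutive u N) (a , b) H.word)
          (H.rainbow _ (swap-below u<k a<k a≢u , swap-below u<k b<k b≢u , a≢b ∘ swap-injective u N))

  count-block-touching : ∀ {u γ} → ¬ Avoids u γ → count γ (block u) ≡ 0
  count-block-touching {u} = count-≡0-Avoids (block u) (block-avoids u)

  -- Block u lacks the colour (a , b) exactly when u ∈ {a , b}; the three lemmas count the blocks
  -- below m according to how many of a and b are below m.
  count-blocks-none : ∀ {a b} m → Colour (suc N) (a , b) → m ≤ suc N → m ≤ a → m ≤ b →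
                  count (a , b) (blocks m) ≡ m * r
  count-blocks-none zero    _   _   _   _   = refl
  count-blocks-none {a} {b} (suc m) γ-colour m<k m<a m<b = begin
    count (a , b) (block m ++ blocks m)                ≡⟨ count-++ (a , b) (block m) (blocks m) ⟩
    count (a , b) (block m) + count (a , b) (blocks m) ≡⟨ cong₂ _+_ (count-block m<k γ-colour (>⇒≢ m<a , >⇒≢ m<b))
                                                                    (count-blocks-none m γ-colour (<⇒≤ m<k) (<⇒≤ m<a) (<⇒≤ m<b)) ⟩
    r + m * r                                          ∎
    where open ≡-Reasoning

  count-blocks-one : ∀ {a b} m → Colour (suc N) (a , b) → m ≤ suc N → m ≤ a → b < m →
                  count (a , b) (blocks m) + r ≡ m * r
  count-blocks-one {a} {b} (suc m) γ-colour m<k m<a b<1+m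
    rewrite count-++ (a , b) (block m) (blocks m) with b ≟ m
  ... | yes refl rewrite count-block-touching {m} {a , m} (λ (_ , m≢m) → m≢m refl)
                       | count-blocks-none m γ-colour (<⇒≤ m<k) (<⇒≤ m<a) ≤-refl = +-comm (m * r) r
  ... | no b≢m rewrite count-block m<k γ-colour (>⇒≢ m<a , b≢m)
                     | +-assoc r (count (a , b) (blocks m)) r =
    cong (r +_) (count-blocks-one m γ-colour (<⇒≤ m<k) (<⇒≤ m<a) (≤∧≢⇒< (≤-pred b<1+m) b≢m))

  count-blocks-both : ∀ {a b} m → Colour (suc N) (a , b) → m ≤ suc N → a < m → b < m →
                  count (a , b) (blocks m) + 2 * r ≡ m * r
  count-blocks-both {a} {b} (suc m) γ-colour@(a<k , b<k , a≢b) m<k a<1+m b<1+m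
    rewrite count-++ (a , b) (block m) (blocks m) with a ≟ m | b ≟ m
  ... | yes refl | _ rewrite count-block-touching {m} {m , b} (λ (m≢m , _) → m≢m refl) =
    trans (rearrange (count (m , b) (blocks m)) r)
          (cong (r +_) (count-blocks-one m γ-colour (<⇒≤ m<k) ≤-refl (≤∧≢⇒< (≤-pred b<1+m) (≢-sym a≢b))))
    where
    rearrange : ∀ x r → x + 2 * r ≡ r + (x + r)
    rearrange = solve-∀
  ... | no a≢m | yes refl rewrite count-block-touching {m} {a , m} (λ (_ , m≢m) → m≢m refl) =
    trans (rearrange (count (a , m) (blocks m)) r)
          (cong (r +_) (trans (cong (_+ r) (count-resp-∼ (blocks m) ∼-flip))
                              (count-blocks-one m (b<k , a<k , ≢-sym a≢b) (<⇒≤ m<k) ≤-refl (≤∧≢⇒< (≤-pred a<1+m) a≢m))))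
    where
    rearrange : ∀ x r → x + 2 * r ≡ r + (x + r)
    rearrange = solve-∀
  ... | no a≢m | no b≢m rewrite count-block m<k γ-colour (a≢m , b≢m)
                              | +-assoc r (count (a , b) (blocks m)) (2 * r) =
    cong (r +_) (count-blocks-both m γ-colour (<⇒≤ m<k) (≤∧≢⇒< (≤-pred a<1+m) a≢m) (≤∧≢⇒< (≤-pred b<1+m) b≢m))

  count-all-blocks : ∀ {γ} → Colour (suc N) γ → count γ (blocks (suc N)) ≡ (3 + n) * r
  count-all-blocks {a , b} γ-colour@(a<k , b<k , _) =
    +-cancelʳ-≡ (2 * r) _ _ (trans (count-blocks-both (suc N) γ-colour ≤-refl a<k b<k) (split n r))
    where
    split : ∀ n r → (5 + n) * r ≡ (3 + n) * r + 2 * r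
    split = solve-∀

  rung : ℕ → Pair
  rung j = j , suc j

  rungs : ℕ → List Pair
  rungs = applyDownFrom rung

  rung-colour : ∀ {i} → i < N → Colour (suc N) (rung i)
  rung-colour i<N = m<n⇒m<1+n i<N , s≤s i<N , ≢-sym 1+n≢n

  rung-∼ : ∀ {i i′} → rung i ∼ rung i′ → i ≡ i′
  rung-∼ (inj₁ (i≡i′ , _))                = i≡i′
  rung-∼ {i} (inj₂ (i≡1+i′ , refl)) = contradiction i≡1+i′ (m≢1+n+m i {1})

  -- Junction j removes an edge of colour tau j from block j + 1, and the path through blocks 0 … j
  -- lacks one as well.  Rotating the rungs by two places makes tau j avoid j and j + 1, so that it
  -- commutes with rung j, and makes the taus and the rungs equal as multisets.
  tau : ℕ → Pair
  tau j = rung ((2 + j) % N)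

  taus : ℕ → List Pair
  taus = applyDownFrom tau

  tau-colour : ∀ j → Colour (suc N) (tau j)
  tau-colour j = rung-colour (m%n<n (2 + j) N)

  tau-shifted : ∀ {j} → 2 + j < N → tau j ≡ rung (2 + j)
  tau-shifted lt = cong rung (m<n⇒m%n≡m lt)

  tau-penultimate : tau (2 + n) ≡ rung 0
  tau-penultimate = cong rung (n%n≡0 N)

  tau-last : tau (3 + n) ≡ rung 1
  tau-last = cong rung ([m+n]%n≡m%n 1 N)

  data TauCase (j : ℕ) : Set where
    shifted     : 2 + j < N → TauCase j
    penultimate : j ≡ 2 + n → TauCase j
    last        : j ≡ 3 + n → TauCase j

  tauCase : ∀ {j} → j < N → TauCase j
  tauCase {j} j<N with <-cmp j (2 + n)
  ... | tri< j<2+n _ _ = shifted (s≤s (s≤s j<2+n))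
  ... | tri≈ _ j≡2+n _ = penultimate j≡2+n
  ... | tri> _ _ 2+n<j = last (≤-antisym (≤-pred j<N) 2+n<j)

  tau-avoids : ∀ {j} → j < N → Avoids j (tau j) × Avoids (suc j) (tau j)
  tau-avoids {j} j<N with tauCase j<N
  ... | shifted lt       = subst (λ c → Avoids j c × Avoids (suc j) c) (sym (tau-shifted lt))
                                 ((m+1+n≢n 1 , m+1+n≢n 2) , (1+n≢n , m+1+n≢n 1))
  ... | penultimate refl = subst (λ c → Avoids j c × Avoids (suc j) c) (sym tau-penultimate)
                                 (((λ ()) , (λ ())) , ((λ ()) , (λ ())))
  ... | last refl        = subst (λ c → Avoids j c × Avoids (suc j) c) (sym tau-last)
                                 (((λ ()) , (λ ())) , ((λ ()) , (λ ())))

  tau-step : ∀ {j} → suc j < N → ¬ tau (suc j) ∼ tau j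
  tau-step {j} 1+j<N with tauCase 1+j<N
  ... | shifted lt       = subst₂ (λ c c′ → ¬ c ∼ c′) (sym (tau-shifted lt)) (sym (tau-shifted (<-trans (n<1+n (2 + j)) lt)))
                                  (1+n≢n ∘ rung-∼)
  ... | penultimate refl = subst₂ (λ c c′ → ¬ c ∼ c′) (sym tau-penultimate) (sym (tau-shifted {1 + n} ≤-refl))
                                  ((λ ()) ∘ rung-∼)
  ... | last refl        = subst₂ (λ c c′ → ¬ c ∼ c′) (sym tau-last) (sym tau-penultimate)
                                  ((λ ()) ∘ rung-∼)

  taus-shifted : ∀ m → m ≤ 2 + n → taus m ≡ applyDownFrom (rung ∘ (2 +_)) m
  taus-shifted zero    _     = refl
  taus-shifted (suc m) m<2+n = cong₂ _∷_ (tau-shifted (s≤s (s≤s m<2+n))) (taus-shifted m (<⇒≤ m<2+n))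

  rungs-split : ∀ m → rungs (2 + m) ≡ applyDownFrom (rung ∘ (2 +_)) m ++ rungs 2
  rungs-split zero    = refl
  rungs-split (suc m) = cong (rung (2 + m) ∷_) (rungs-split m)

  taus-rotated : taus N ≡ rungs 2 ++ applyDownFrom (rung ∘ (2 +_)) (2 + n)
  taus-rotated = cong₂ _∷_ tau-last (cong₂ _∷_ tau-penultimate (taus-shifted (2 + n) ≤-refl))

  count-taus : ∀ γ → count γ (taus N) ≡ count γ (rungs N)
  count-taus γ = begin
    count γ (taus N)                                ≡⟨ cong (count γ) taus-rotated ⟩
    count γ (rungs 2 ++ rotated)                    ≡⟨ count-++ γ (rungs 2) rotated ⟩
    count γ (rungs 2) + count γ rotated             ≡⟨ +-comm (count γ (rungs 2)) _ ⟩
    count γ rotated + count γ (rungs 2)             ≡⟨ count-++ γ rotated (rungs 2) ⟨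
    count γ (rotated ++ rungs 2)                    ≡⟨ cong (count γ) (rungs-split (2 + n)) ⟨
    count γ (rungs N)                               ∎
    where
    open ≡-Reasoning
    rotated = applyDownFrom (rung ∘ (2 +_)) (2 + n)

  record BlockPath (u : ℕ) : Set where
    field
      route         : List Pair
      route-colours : All (Colour (suc N)) route
      route-avoids  : All (Avoids u) route
      route-path    : Path (tau u) route
      route-count   : ∀ γ → count γ route + count γ [ tau u ] ≡ count γ (block u)
      route-size    : length route + 1 ≡ length H.word

  blockPath : ∀ {u} → u < N → BlockPath u
  blockPath {u} u<N with occurrence (tau u) (block u) (subst (1 ≤_) (sym count-tau) 1≤r)
    where
    count-tau : count (tau u) (block u) ≡ r
    count-tau = count-block (m<n⇒m<1+n u<N) (tau-colour u) (proj₁ (tau-avoids u<N))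
  ... | E , c , F , block≡ , tau∼c = record
    { route         = F ++ E
    ; route-colours = proj₁ (All-rotate E c F (subst (All (Colour (suc N))) block≡ (block-colours (m<n⇒m<1+n u<N))))
    ; route-avoids  = proj₁ (All-rotate E c F (subst (All (Avoids u)) block≡ (block-avoids u)))
    ; route-path    = Path-resp-∼ (∼-sym tau∼c) (Cycle-open E c F (subst Cycle block≡ (block-cycle u)))
    ; route-count   = λ γ → trans (cong (count γ (F ++ E) +_) (count-[]-resp-∼ γ tau∼c))
                                  (trans (count-rotate γ E c F) (cong (count γ) (sym block≡)))
    ; route-size    = trans (length-rotate E c F) (trans (cong length (sym block≡)) (block-length u))
    }

  record GluedPath (j : ℕ) : Set where
    field
      path     : List Pair
      colours  : All (Colour (suc N)) path
      ends     : ∀ z → Onto z → z N ≡ j → walk z path ≗ ⟦ tau j ⟧ ∘ z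
      distinct : ∀ z → Onto z → z N ≡ j → Distinct (visits⁺ z path)
      below    : ∀ z → Onto z → z N ≡ j → All (λ V → V N ≤ j) (visits⁺ z path)
      -- every junction i < j has traded two edges of colour tau i for two rungs i
      counts   : ∀ γ → count γ path + count γ [ tau j ] + 2 * count γ (taus j)
                       ≡ count γ (blocks (suc j)) + 2 * count γ (rungs j)
      size     : length path + 1 ≡ suc j * length H.word

  gluedPath₀ : GluedPath 0
  gluedPath₀ = record
    { path     = route
    ; colours  = route-colours
    ; ends     = λ z z-onto _ → proj₁ (route-path z z-onto)
    ; distinct = λ z z-onto _ → proj₂ (route-path z z-onto)
    ; below    = λ z _ zN≡0 → All.map ≤-reflexive (visits⁺-keep N z route route-avoids zN≡0)
    ; counts   = λ γ → trans (+-identityʳ _)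
                             (trans (route-count γ) (sym (trans (+-identityʳ _) (trans (count-++ γ (block 0) []) (+-identityʳ _)))))
    ; size     = trans route-size (sym (+-identityʳ _))
    }
    where open BlockPath (blockPath {0} (s≤s z≤n))

  private
    reassociate : ∀ (xs : List Fun) x ys zs ws → (xs ++ x ∷ ys ++ zs) ++ ws ≡ (xs ++ [ x ]) ++ ys ++ zs ++ ws
    reassociate []       x ys zs ws = cong (x ∷_) (++-assoc ys zs ws)
    reassociate (v ∷ xs) x ys zs ws = cong (v ∷_) (reassociate xs x ys zs ws)

    glue-count : ∀ cA cB cρ cP t₀ t₁ T Bl Rg cW →
                 cP + t₀ + 2 * T ≡ Bl + 2 * Rg → cA + (t₀ + cB) + t₁ ≡ cW →
                 cA + (cρ + (cP + (cρ + cB))) + t₁ + 2 * (t₀ + T) ≡ cW + Bl + 2 * (cρ + Rg)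
    glue-count cA cB cρ cP t₀ t₁ T Bl Rg cW old new = begin
      cA + (cρ + (cP + (cρ + cB))) + t₁ + 2 * (t₀ + T)   ≡⟨ regroup cA cB cρ cP t₀ t₁ T ⟩
      (cA + (t₀ + cB) + t₁) + (cP + t₀ + 2 * T) + 2 * cρ ≡⟨ cong₂ (λ x y → x + y + 2 * cρ) new old ⟩
      cW + (Bl + 2 * Rg) + 2 * cρ                        ≡⟨ collect cW Bl Rg cρ ⟩
      cW + Bl + 2 * (cρ + Rg)                            ∎
      where
      open ≡-Reasoning
      regroup : ∀ cA cB cρ cP t₀ t₁ T →
                cA + (cρ + (cP + (cρ + cB))) + t₁ + 2 * (t₀ + T) ≡ (cA + (t₀ + cB) + t₁) + (cP + t₀ + 2 * T) + 2 * cρ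
      regroup = solve-∀
      collect : ∀ cW Bl Rg cρ → cW + (Bl + 2 * Rg) + 2 * cρ ≡ cW + Bl + 2 * (cρ + Rg)
      collect = solve-∀

  -- The junction: the edge c of a walk in block j + 1 becomes rung j, a glued path through the
  -- blocks 0 … j, and rung j again; the walk still ends where it did since rung j commutes with c.
  module Insertion {j} (G : GluedPath j) (A : List Pair) (c : Pair) (B : List Pair)
                   (tau∼c : tau j ∼ c) (A-avoids : All (Avoids (suc j)) A) (j<N : j < N) where

    private module G = GluedPath G

    inserted : List Pair
    inserted = A ++ rung j ∷ G.path ++ rung j ∷ B

    module _ (z : Fun) (z-onto : Onto z) (zN : z N ≡ suc j) where

      private
        a  = walk z A
        z′ = ⟦ rung j ⟧ ∘ a

        z′N : z′ N ≡ j
        z′N = trans (cong (swap j (suc j)) (walk-keeps N z A A-avoids zN)) (swap-ʳ j (suc j))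

        z′-onto : Onto z′
        z′-onto = ⟦⟧∘-onto (rung j) (walk-onto A z-onto)

        commute : ∀ x → ⟦ rung j ⟧ (⟦ c ⟧ x) ≡ ⟦ c ⟧ (⟦ rung j ⟧ x)
        commute x with Avoids-resp-∼ tau∼c (proj₁ (tau-avoids j<N)) | Avoids-resp-∼ tau∼c (proj₂ (tau-avoids j<N))
        ... | p≢j , q≢j | p≢1+j , q≢1+j = sym (swap-swap-disjoint p≢j p≢1+j q≢j q≢1+j x)

        G-path : walk z′ G.path ≗ ⟦ c ⟧ ∘ z′
        G-path x = trans (G.ends z′ z′-onto z′N x) (⟦⟧-resp-∼ tau∼c (z′ x))

      open Splice z A (rung j) G.path c B G-path commute

      inserted-walk : walk z inserted ≗ walk z (A ++ c ∷ B)
      inserted-walk = splice-walk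

      inserted-visits : ∀ T → Distinct (visits z (A ++ c ∷ B) ++ T) → All (λ V → V N ≡ suc j) (visits z (A ++ c ∷ B) ++ T) →
                        Distinct (visits z inserted ++ T) × All (λ V → V N ≤ suc j) (visits z inserted ++ T)
      inserted-visits T distinct at =
        Distinct-resp-≋ (≋-sym new) (proj₁ combined) , All-resp-≋ (≤-resp-≗ N) (≋-sym new) (proj₂ combined)
        where
        X = visits z A ++ [ a ]
        Y = visits⁺ z′ G.path
        Z = visits (⟦ c ⟧ ∘ a) B
        old : visits z (A ++ c ∷ B) ++ T ≡ X ++ Z ++ T
        old = trans (cong (_++ T) (visits-++ z A (c ∷ B))) (reassociate (visits z A) a [] Z T)
        new : visits z inserted ++ T ≋ X ++ Y ++ Z ++ T
        new = subst (visits z inserted ++ T ≋_) (reassociate (visits z A) a Y Z T) (Pointwise.++⁺ splice-visits ≋-refl)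
        combined = Distinct-insert-below N X (subst Distinct old distinct) (subst (All _) old at)
                                         (G.distinct z′ z′-onto z′N) (G.below z′ z′-onto z′N)

    inserted-colours : All (Colour (suc N)) (A ++ c ∷ B) → All (Colour (suc N)) inserted
    inserted-colours colours with All.++⁻ A colours
    ... | A-colours , _ ∷ B-colours =
      All.++⁺ A-colours (rung-colour j<N ∷ All.++⁺ G.colours (rung-colour j<N ∷ B-colours))

    inserted-counts : ∀ γ t → count γ (A ++ c ∷ B) + t ≡ count γ (block (suc j)) →
                      count γ inserted + t + 2 * count γ (taus (suc j)) ≡ count γ (blocks (2 + j)) + 2 * count γ (rungs (suc j))
    inserted-counts γ t block-count = begin
      count γ inserted + t + 2 * count γ (tau j ∷ taus j)
        ≡⟨ cong₂ (λ x y → x + t + 2 * y) split-inserted (count-∷ γ (tau j) (taus j)) ⟩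
      count γ A + (ρ + (count γ G.path + (ρ + count γ B))) + t + 2 * (count γ [ tau j ] + count γ (taus j))
        ≡⟨ glue-count (count γ A) (count γ B) ρ (count γ G.path) (count γ [ tau j ]) t (count γ (taus j))
                      (count γ (blocks (suc j))) (count γ (rungs j)) (count γ (block (suc j))) (G.counts γ)
                      (trans (cong (_+ t) (sym split-original)) block-count) ⟩
      count γ (block (suc j)) + count γ (blocks (suc j)) + 2 * (ρ + count γ (rungs j))
        ≡⟨ cong₂ (λ x y → x + 2 * y) (count-++ γ (block (suc j)) (blocks (suc j))) (count-∷ γ (rung j) (rungs j)) ⟨
      count γ (blocks (2 + j)) + 2 * count γ (rungs (suc j)) ∎
      where
      open ≡-Reasoning
      ρ = count γ [ rung j ]
      split-inserted : count γ inserted ≡ count γ A + (ρ + (count γ G.path + (ρ + count γ B)))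
      split-inserted = trans (count-++ γ A _) (cong (count γ A +_) (trans (count-∷ γ (rung j) _)
                         (cong (ρ +_) (trans (count-++ γ G.path _) (cong (count γ G.path +_) (count-∷ γ (rung j) B))))))
      split-original : count γ (A ++ c ∷ B) ≡ count γ A + (count γ [ tau j ] + count γ B)
      split-original = trans (count-++ γ A (c ∷ B))
                             (cong (count γ A +_) (trans (count-∷ γ c B) (cong (_+ count γ B) (count-[]-resp-∼ γ (∼-sym tau∼c)))))

    inserted-size : length inserted ≡ length (A ++ c ∷ B) + (length G.path + 1)
    inserted-size = trans (length-++ A) (trans (cong (λ x → length A + suc x) (length-++ G.path))
                          (trans (regroup (length A) (length B) (length G.path)) (cong (_+ (length G.path + 1)) (sym (length-++ A)))))
      where
      regroup : ∀ a b p → a + suc (p + suc b) ≡ a + suc b + (p + 1)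
      regroup = solve-∀

  module Step {j} (1+j<N : suc j < N) (G : GluedPath j) (P : BlockPath (suc j)) where

    open BlockPath P
    private
      module G = GluedPath G
      j<N = <-trans (n<1+n j) 1+j<N

    count-route : count (tau j) route ≡ r
    count-route = begin
      count (tau j) route                                   ≡⟨ +-identityʳ _ ⟨
      count (tau j) route + 0                               ≡⟨ cong (count (tau j) route +_) tau-absent ⟨
      count (tau j) route + count (tau j) [ tau (suc j) ]   ≡⟨ route-count (tau j) ⟩
      count (tau j) (block (suc j))                         ≡⟨ count-block (m<n⇒m<1+n 1+j<N) (tau-colour j) (proj₂ (tau-avoids j<N)) ⟩
      r                                                     ∎
      where
      open ≡-Reasoning
      tau-absent = count-≡0 [ tau (suc j) ] ((tau-step 1+j<N ∘ ∼-sym) ∷ [])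

    glued : GluedPath (suc j)
    glued with occurrence (tau j) route (subst (1 ≤_) (sym count-route) 1≤r)
    ... | A , c , B , refl , tau∼c = record
      { path     = inserted
      ; colours  = inserted-colours route-colours
      ; ends     = λ z z-onto zN x → trans (inserted-walk z z-onto zN x) (proj₁ (route-path z z-onto) x)
      ; distinct = λ z z-onto zN → proj₁ (vertices z z-onto zN)
      ; below    = λ z z-onto zN → proj₂ (vertices z z-onto zN)
      ; counts   = λ γ → inserted-counts γ _ (route-count γ)
      ; size     = trans (cong (_+ 1) inserted-size) (trans (regroup (length route) _) (cong₂ _+_ route-size G.size))
      }
      where
      open Insertion G A c B tau∼c (All.++⁻ˡ A route-avoids) j<N

      regroup : ∀ x y → x + y + 1 ≡ x + 1 + y
      regroup = solve-∀

      vertices : ∀ z → Onto z → z N ≡ suc j →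
                 Distinct (visits⁺ z inserted) × All (λ V → V N ≤ suc j) (visits⁺ z inserted)
      vertices z z-onto zN with inserted-visits z z-onto zN [ walk z route ] (proj₂ (route-path z z-onto))
                                  (visits⁺-keep N z route route-avoids zN)
      ... | distinct , below = Distinct-resp-≋ same-end distinct , All-resp-≋ (≤-resp-≗ N) same-end below
        where
        same-end : visits z inserted ++ [ walk z route ] ≋ visits⁺ z inserted
        same-end = Pointwise.++⁺ ≋-refl (≗.sym (inserted-walk z z-onto zN) ∷ [])

  gluedPath : ∀ {j} → j < N → GluedPath j
  gluedPath {zero}  _     = gluedPath₀
  gluedPath {suc j} 1+j<N = Step.glued 1+j<N (gluedPath (<-trans (n<1+n j) 1+j<N)) (blockPath 1+j<N)

  module Top (G : GluedPath (3 + n)) where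

    private module G = GluedPath G

    count-top : count (tau (3 + n)) (block N) ≡ r
    count-top = count-block (n<1+n N) (tau-colour (3 + n)) (proj₂ (tau-avoids ≤-refl))

    glued : Σ (RainbowWord (suc N) ((3 + n) * r)) λ R → length (RainbowWord.word R) ≡ suc N * length H.word
    glued with occurrence (tau (3 + n)) (block N) (subst (1 ≤_) (sym count-top) 1≤r)
    ... | A , c , B , block≡ , tau∼c = record
      { word     = inserted
      ; colours  = inserted-colours (subst (All (Colour (suc N))) block≡ (block-colours (n<1+n N)))
      ; closed   = λ x → trans (inserted-walk id id-onto refl x)
                               (trans (cong (λ w → walk id w x) (sym block≡)) (proj₁ (block-cycle N id id-onto) x))
      ; distinct = subst Distinct (++-identityʳ _)
                     (proj₁ (inserted-visits id id-onto refl []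
                       (subst Distinct (sym (++-identityʳ _)) (subst (Distinct ∘ visits id) block≡ (proj₂ (block-cycle N id id-onto))))
                       (subst (All _) (sym (++-identityʳ _)) (visits-keep N id (A ++ c ∷ B) W-avoids refl))))
      ; rainbow  = rainbow
      } , trans inserted-size (cong₂ _+_ (trans (cong length (sym block≡)) (block-length N)) G.size)
      where
      W-avoids : All (Avoids N) (A ++ c ∷ B)
      W-avoids = subst (All (Avoids N)) block≡ (block-avoids N)

      open Insertion G A c B tau∼c (All.++⁻ˡ A W-avoids) ≤-refl

      rainbow : ∀ γ → Colour (suc N) γ → count γ inserted ≡ (3 + n) * r
      rainbow γ γ-colour = begin
        count γ inserted                                             ≡⟨ +-cancelʳ-≡ (2 * count γ (rungs N)) _ _ total ⟩
        count γ (blocks (suc N))                                     ≡⟨ count-all-blocks γ-colour ⟩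
        (3 + n) * r                                                  ∎
        where
        open ≡-Reasoning
        total : count γ inserted + 2 * count γ (rungs N) ≡ count γ (blocks (suc N)) + 2 * count γ (rungs N)
        total = trans (cong₂ (λ x y → x + 2 * y) (sym (+-identityʳ (count γ inserted))) (sym (count-taus γ)))
                      (inserted-counts γ 0 (trans (+-identityʳ _) (cong (count γ) (sym block≡))))

  glued : Σ (RainbowWord (suc N) ((3 + n) * r)) λ R → length (RainbowWord.word R) ≡ suc N * length H.word
  glued = Top.glued (gluedPath ≤-refl)

UsedFixing : ℕ → Pair → Fun → List Pair → Set
UsedFixing p c y []      = ⊤
UsedFixing p c y (x ∷ w) = (c ∼ x → y p ≡ p) × UsedFixing p c (⟦ x ⟧ ∘ y) w

UsedFixing-avoiding : ∀ {p c} y w → All (Avoids p) w → y p ≡ p → UsedFixing p c y w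
UsedFixing-avoiding y []      []                   yp≡p = tt
UsedFixing-avoiding y (x ∷ w) (x-avoids ∷ avoids) yp≡p =
  (λ _ → yp≡p) , UsedFixing-avoiding (⟦ x ⟧ ∘ y) w avoids (trans (cong ⟦ x ⟧ yp≡p) (⟦⟧-fixes x x-avoids))

-- Each of the first j edges x of colour c becomes σ x σ, which acts like x since c avoids l and p.
module Detour (p l : ℕ) (c : Pair) (c-avoids-p : Avoids p c) (c-avoids-l : Avoids l c) where

  σ : Pair
  σ = l , p

  insertDetours : ℕ → List Pair → List Pair
  insertDetours zero    w       = w
  insertDetours (suc j) []      = []
  insertDetours (suc j) (x ∷ w) with c ∼? x
  ... | yes _ = σ ∷ x ∷ σ ∷ insertDetours j w
  ... | no _  = x ∷ insertDetours (suc j) w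

  replacedEnds : Fun → ℕ → List Pair → List Fun
  replacedEnds y zero    w       = []
  replacedEnds y (suc j) []      = []
  replacedEnds y (suc j) (x ∷ w) with c ∼? x
  ... | yes _ = y ∷ (⟦ x ⟧ ∘ y) ∷ replacedEnds (⟦ x ⟧ ∘ y) j w
  ... | no _  = replacedEnds (⟦ x ⟧ ∘ y) (suc j) w

  detourVertices : Fun → ℕ → List Pair → List Fun
  detourVertices y j w = map (⟦ σ ⟧ ∘_) (replacedEnds y j w)

  private
    commute : ∀ {x} → c ∼ x → ∀ z → ⟦ x ⟧ (⟦ σ ⟧ z) ≡ ⟦ σ ⟧ (⟦ x ⟧ z)
    commute {a , b} c∼x z with Avoids-resp-∼ c∼x c-avoids-l | Avoids-resp-∼ c∼x c-avoids-p
    ... | a≢l , b≢l | a≢p , b≢p = swap-swap-disjoint a≢l a≢p b≢l b≢p z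

    detour≗ : ∀ {x} → c ∼ x → ∀ {y y′ : Fun} → y ≗ y′ → ⟦ x ⟧ ∘ y ≗ ⟦ σ ⟧ ∘ ⟦ x ⟧ ∘ ⟦ σ ⟧ ∘ y′
    detour≗ {x} c∼x {y} {y′} y≗y′ z = trans (cong ⟦ x ⟧ (y≗y′ z))
      (trans (sym (⟦⟧-involutive σ _)) (cong ⟦ σ ⟧ (sym (commute c∼x (y′ z)))))

  walk-insertDetours : ∀ {y y′} j w → y ≗ y′ → walk y′ (insertDetours j w) ≗ walk y w
  walk-insertDetours zero    w       y≗y′ = ≗.sym (walk-cong w y≗y′)
  walk-insertDetours (suc j) []      y≗y′ = ≗.sym y≗y′
  walk-insertDetours (suc j) (x ∷ w) y≗y′ with c ∼? x
  ... | yes c∼x = walk-insertDetours j w (detour≗ c∼x y≗y′)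
  ... | no _    = walk-insertDetours (suc j) w (⟦⟧∘-cong x y≗y′)

  visits-insertDetours : ∀ {y y′} j w → y ≗ y′ → Interleaved (visits y w) (detourVertices y j w) (visits y′ (insertDetours j w))
  visits-insertDetours zero    w       y≗y′ = interleave-left (visits-cong w y≗y′)
    where
    interleave-left : ∀ {xs zs} → xs ≋ zs → Interleaved xs [] zs
    interleave-left []            = []
    interleave-left (x≗z ∷ xs≋zs) = x≗z ∷ˡ interleave-left xs≋zs
  visits-insertDetours (suc j) []      y≗y′ = []
  visits-insertDetours {y} {y′} (suc j) (x ∷ w) y≗y′ with c ∼? x
  ... | yes c∼x = y≗y′ ∷ˡ ⟦⟧∘-cong σ y≗y′ ∷ʳ (λ z → trans (cong (⟦ σ ⟧ ∘ ⟦ x ⟧) (y≗y′ z)) (sym (commute c∼x (y′ z))))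
                  ∷ʳ visits-insertDetours j w (detour≗ c∼x y≗y′)
  ... | no _    = y≗y′ ∷ˡ visits-insertDetours (suc j) w (⟦⟧∘-cong x y≗y′)

  count-insertDetours : ∀ γ j w → j ≤ count c w → count γ (insertDetours j w) ≡ count γ w + j * (2 * count γ [ σ ])
  count-insertDetours γ zero    w       _ = sym (+-identityʳ _)
  count-insertDetours γ (suc j) (x ∷ w) j<count with c ∼? x
  ... | yes _ = begin
    count γ (σ ∷ x ∷ σ ∷ insertDetours j w)
      ≡⟨ trans (count-∷ γ σ _) (cong (s +_) (trans (count-∷ γ x _) (cong (count γ [ x ] +_) (count-∷ γ σ _)))) ⟩
    s + (count γ [ x ] + (s + count γ (insertDetours j w)))
      ≡⟨ cong (λ k → s + (count γ [ x ] + (s + k))) (count-insertDetours γ j w (≤-pred j<count)) ⟩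
    s + (count γ [ x ] + (s + (count γ w + j * (2 * s))))
      ≡⟨ rearrange s (count γ [ x ]) (count γ w) j ⟩
    count γ [ x ] + count γ w + suc j * (2 * s)
      ≡⟨ cong (_+ suc j * (2 * s)) (count-∷ γ x w) ⟨
    count γ (x ∷ w) + suc j * (2 * s) ∎
    where
    open ≡-Reasoning
    s = count γ [ σ ]
    rearrange : ∀ s x c j → s + (x + (s + (c + j * (2 * s)))) ≡ x + c + suc j * (2 * s)
    rearrange = solve-∀
  ... | no _ = begin
    count γ (x ∷ insertDetours (suc j) w)                ≡⟨ count-∷ γ x _ ⟩
    count γ [ x ] + count γ (insertDetours (suc j) w)    ≡⟨ cong (count γ [ x ] +_) (count-insertDetours γ (suc j) w j<count) ⟩
    count γ [ x ] + (count γ w + suc j * (2 * s))        ≡⟨ +-assoc (count γ [ x ]) _ _ ⟨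
    count γ [ x ] + count γ w + suc j * (2 * s)          ≡⟨ cong (_+ suc j * (2 * s)) (count-∷ γ x w) ⟨
    count γ (x ∷ w) + suc j * (2 * s)                    ∎
    where
    open ≡-Reasoning
    s = count γ [ σ ]

  private
    All-visits-head : ∀ {P : Fun → Set} {f} w → 1 ≤ count c w → All P (visits f w) → P f
    All-visits-head (x ∷ w) _ (pf ∷ _) = pf

  mutual
    replacedEnds-⊆ : ∀ y j w → Distinct (visits y w) → j < count c w → replacedEnds y j w ⊆ visits y w
    replacedEnds-⊆ y zero    w       _                  _       = minimum _
    replacedEnds-⊆ y (suc j) (x ∷ w) distinct@(_ ∷ rest) j<count with c ∼? x
    ... | yes c∼x = refl ∷ replacedEnds-after-⊆ y x j w c∼x distinct (≤-pred j<count)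
    ... | no _    = y ∷ʳ replacedEnds-⊆ (⟦ x ⟧ ∘ y) (suc j) w rest j<count

    -- two consecutive edges of colour c would lead back to y
    replacedEnds-after-⊆ : ∀ y x j w → c ∼ x → Distinct (y ∷ visits (⟦ x ⟧ ∘ y) w) → j < count c w →
                           (⟦ x ⟧ ∘ y) ∷ replacedEnds (⟦ x ⟧ ∘ y) j w ⊆ visits (⟦ x ⟧ ∘ y) w
    replacedEnds-after-⊆ y x zero    (x′ ∷ w) _   _                          _       = refl ∷ minimum _
    replacedEnds-after-⊆ y x (suc j) (x′ ∷ w) c∼x (y≉ ∷ _ ∷ distinct) j<count with c ∼? x′
    ... | no _     = refl ∷ replacedEnds-⊆ (⟦ x′ ⟧ ∘ ⟦ x ⟧ ∘ y) (suc j) w distinct j<count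
    ... | yes c∼x′ = contradiction back (All-visits-head w (≤-trans (s≤s z≤n) (≤-pred j<count)) (All.tail y≉))
      where
      back : y ≗ ⟦ x′ ⟧ ∘ ⟦ x ⟧ ∘ y
      back z = sym (trans (⟦⟧-resp-∼ (∼-sym c∼x′) (⟦ x ⟧ (y z)))
                          (trans (cong ⟦ c ⟧ (⟦⟧-resp-∼ (∼-sym c∼x) (y z))) (⟦⟧-involutive c (y z))))

  replacedEnds-fix : ∀ y j w → UsedFixing p c y w → All (λ u → u p ≡ p) (replacedEnds y j w)
  replacedEnds-fix y zero    w       _              = []
  replacedEnds-fix y (suc j) []      _              = []
  replacedEnds-fix y (suc j) (x ∷ w) (fix , fixes) with c ∼? x
  ... | yes c∼x = fix c∼x ∷ trans (cong ⟦ x ⟧ (fix c∼x)) (⟦⟧-fixes x (Avoids-resp-∼ c∼x c-avoids-p))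
                          ∷ replacedEnds-fix (⟦ x ⟧ ∘ y) j w fixes
  ... | no _    = replacedEnds-fix (⟦ x ⟧ ∘ y) (suc j) w fixes

  detourVertices-at : ∀ y j w → UsedFixing p c y w → All (λ V → V p ≡ l) (detourVertices y j w)
  detourVertices-at y j w fixes =
    All.map⁺ (All.map (λ up≡p → trans (cong (swap l p) up≡p) (swap-ʳ l p)) (replacedEnds-fix y j w fixes))

  Distinct-insertDetours : ∀ y j w → Distinct (visits y w) → j < count c w → UsedFixing p c y w →
                           All (λ V → V p ≢ l) (visits y w) → Distinct (visits y (insertDetours j w))
  Distinct-insertDetours y j w distinct j<count fixes not-at =
    Distinct-interleaved (visits-insertDetours j w ≗.refl) distinct
      (Distinct-∘ˡ (⟦⟧-injective σ) (Distinct-⊆ (replacedEnds-⊆ y j w distinct j<count) distinct))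
      (Apart-separated {P = λ V → V p ≢ l} {Q = λ V → V p ≡ l} (λ {V} → λ Vp≢l → Vp≢l)
                       (λ V≗W Vp≢l → Vp≢l ∘ trans (V≗W p)) not-at (detourVertices-at y j w fixes))

  All-insertDetours : ∀ {P : Fun → Set} → P Respects _≗_ → ∀ y j w → All P (visits y w) → All P (detourVertices y j w) →
                      All P (visits y (insertDetours j w))
  All-insertDetours resp y j w = All-interleaved resp (visits-insertDetours j w ≗.refl)

  colours-insertDetours : ∀ {P : Pair → Set} → P σ → ∀ j w → All P w → All P (insertDetours j w)
  colours-insertDetours pσ zero    w       pw         = pw
  colours-insertDetours pσ (suc j) []      []         = []
  colours-insertDetours pσ (suc j) (x ∷ w) (px ∷ pw) with c ∼? x
  ... | yes _ = pσ ∷ px ∷ pσ ∷ colours-insertDetours pσ j w pw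
  ... | no _  = px ∷ colours-insertDetours pσ (suc j) w pw

  UsedFixing-cong : ∀ {c′ y y′} w → y ≗ y′ → UsedFixing p c′ y w → UsedFixing p c′ y′ w
  UsedFixing-cong []      y≗y′ tt            = tt
  UsedFixing-cong (x ∷ w) y≗y′ (fix , fixes) =
    trans (sym (y≗y′ p)) ∘ fix , UsedFixing-cong w (⟦⟧∘-cong x y≗y′) fixes

  UsedFixing-insertDetours : ∀ {c′} → ¬ c′ ∼ c → ¬ c′ ∼ σ → ∀ {y y′} j w → y ≗ y′ →
                             UsedFixing p c′ y w → UsedFixing p c′ y′ (insertDetours j w)
  UsedFixing-insertDetours c′≁c c′≁σ zero    w       y≗y′ fixes = UsedFixing-cong w y≗y′ fixes
  UsedFixing-insertDetours c′≁c c′≁σ (suc j) []      y≗y′ fixes = tt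
  UsedFixing-insertDetours c′≁c c′≁σ (suc j) (x ∷ w) y≗y′ (fix , fixes) with c ∼? x
  ... | yes c∼x = (λ c′∼σ → contradiction c′∼σ c′≁σ) ,
                  (λ c′∼x → contradiction (∼-trans c′∼x (∼-sym c∼x)) c′≁c) ,
                  (λ c′∼σ → contradiction c′∼σ c′≁σ) ,
                  UsedFixing-insertDetours c′≁c c′≁σ j w (detour≗ c∼x y≗y′) fixes
  ... | no _    = trans (sym (y≗y′ p)) ∘ fix ,
                  UsedFixing-insertDetours c′≁c c′≁σ (suc j) w (⟦⟧∘-cong x y≗y′) fixes

module Detours {N s : ℕ} (3≤N : 3 ≤ N) (1≤s : 1 ≤ s) (C : RainbowWord N (2 * s)) where

  private module C = RainbowWord C

  -- Distinct l get distinct colours, so the detours through l leave the edges used for l′ > l alone.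
  detourColour : ℕ → Pair
  detourColour zero    = 1 , 2
  detourColour (suc l) with 2 + l <? N
  ... | yes _ = 0 , 2 + l
  ... | no _  = 0 , 1

  detourColour-colour : ∀ l → Colour N (detourColour l)
  detourColour-colour zero = ≤-trans (s≤s (s≤s z≤n)) 3≤N , 3≤N , (λ ())
  detourColour-colour (suc l) with 2 + l <? N
  ... | yes 2+l<N = ≤-trans (s≤s z≤n) 3≤N , 2+l<N , (λ ())
  ... | no _      = ≤-trans (s≤s z≤n) 3≤N , ≤-trans (s≤s (s≤s z≤n)) 3≤N , (λ ())

  detourColour-avoids : ∀ l → Avoids l (detourColour l)
  detourColour-avoids zero = (λ ()) , (λ ())
  detourColour-avoids (suc l) with 2 + l <? N
  ... | yes _     = (λ ()) , 1+n≢n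
  ... | no 2+l≮N = (λ ()) , λ 1≡1+l → 2+l≮N (subst (λ l → 2 + l < N) (suc-injective 1≡1+l) 3≤N)

  detourColour-distinct : ∀ {l l′} → l < l′ → l′ < N → ¬ detourColour l′ ∼ detourColour l
  detourColour-distinct {zero} {suc l′} _ _ with 2 + l′ <? N
  ... | yes _ = λ { (inj₁ (() , _)) ; (inj₂ (() , _)) }
  ... | no _  = λ { (inj₁ (() , _)) ; (inj₂ (() , _)) }
  detourColour-distinct {suc l} {suc l′} (s≤s l<l′) 1+l′<N with 2 + l <? N | 2 + l′ <? N
  ... | yes _ | yes _ = λ { (inj₁ (_ , 2+l′≡2+l)) → <⇒≢ l<l′ (sym (+-cancelˡ-≡ 2 _ _ 2+l′≡2+l))
                          ; (inj₂ (() , _)) }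
  ... | yes _ | no _  = λ { (inj₁ (_ , ())) ; (inj₂ (() , _)) }
  ... | no _  | yes _ = λ { (inj₁ (_ , ())) ; (inj₂ (() , _)) }
  ... | no 2+l≮N | no _ = λ _ → 2+l≮N (≤-<-trans (s≤s l<l′) 1+l′<N)

  spokes : ℕ → List Pair
  spokes = applyDownFrom (_, N)

  count-spokes-avoiding : ∀ {γ} m → Avoids N γ → count γ (spokes m) ≡ 0
  count-spokes-avoiding m γ-avoids = count-≡0 (spokes m) (All.applyDownFrom⁺₁ _ m (λ {i} _ → ≁-touching i γ-avoids))

  count-spokes-above : ∀ {a} m → m ≤ a → a < N → count (a , N) (spokes m) ≡ 0
  count-spokes-above zero    _     _   = refl
  count-spokes-above {a} (suc m) m<a a<N = trans (count-∷ (a , N) (m , N) (spokes m))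
    (cong₂ _+_ (count-[]-no λ { (inj₁ (a≡m , _)) → >⇒≢ m<a a≡m ; (inj₂ (a≡N , _)) → <⇒≢ a<N a≡N })
               (count-spokes-above m (<⇒≤ m<a) a<N))

  count-spokes-hit : ∀ {a} m → a < m → m ≤ N → count (a , N) (spokes m) ≡ 1
  count-spokes-hit {a} (suc m) a<1+m 1+m≤N with m≤n⇒m<n∨m≡n (≤-pred a<1+m)
  ... | inj₂ refl = trans (count-∷ (a , N) (a , N) (spokes a))
                          (cong₂ _+_ (count-[]-yes {a , N} ∼-refl) (count-spokes-above a ≤-refl 1+m≤N))
  ... | inj₁ a<m  = trans (count-∷ (a , N) (m , N) (spokes m))
                          (cong₂ _+_ (count-[]-no λ { (inj₁ (a≡m , _)) → <⇒≢ a<m a≡m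
                                                    ; (inj₂ (a≡N , _)) → <⇒≢ (<-≤-trans a<1+m 1+m≤N) a≡N })
                                     (count-spokes-hit m a<m (<⇒≤ 1+m≤N)))

  record Detoured (l : ℕ) : Set where
    field
      word     : List Pair
      colours  : All (Colour (suc N)) word
      closed   : walk id word ≗ id
      distinct : Distinct (visits id word)
      counts   : ∀ γ → count γ word ≡ count γ C.word + s * (2 * count γ (spokes l))
      fixing   : ∀ {l′} → l ≤ l′ → l′ < N → UsedFixing N (detourColour l′) id word
      home     : All (λ V → V N ≡ N ⊎ V N < l) (visits id word)

  detoured₀ : Detoured 0
  detoured₀ = record
    { word     = C.word
    ; colours  = All.map Colour-suc C.colours
    ; closed   = C.closed
    ; distinct = C.distinct
    ; counts   = λ γ → sym (trans (cong (count γ C.word +_) (*-zeroʳ s)) (+-identityʳ _))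
    ; fixing   = λ _ _ → UsedFixing-avoiding id C.word C-avoids refl
    ; home     = All.map inj₁ (visits-keep N id C.word C-avoids refl)
    }
    where
    C-avoids = All.map Colour⇒Avoids C.colours

  detoured-step : ∀ {l} → l < N → Detoured l → Detoured (suc l)
  detoured-step {l} l<N D = record
    { word     = insertDetours s D.word
    ; colours  = colours-insertDetours (m<n⇒m<1+n l<N , n<1+n N , <⇒≢ l<N) s D.word D.colours
    ; closed   = λ x → trans (walk-insertDetours s D.word ≗.refl x) (D.closed x)
    ; distinct = Distinct-insertDetours id s D.word D.distinct s<count (D.fixing ≤-refl l<N) (All.map (λ {V} → not-at-l {V}) D.home)
    ; counts   = counts
    ; fixing   = λ {l′} l<l′ l′<N → UsedFixing-insertDetours (detourColour-distinct l<l′ l′<N)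
                                      (≁-touching l (Colour⇒Avoids (detourColour-colour l′))) s D.word ≗.refl
                                      (D.fixing (<⇒≤ l<l′) l′<N)
    ; home     = All-insertDetours home-resp id s D.word (All.map (Sum.map₂ m<n⇒m<1+n) D.home)
                   (All.map (λ VN≡l → inj₂ (≤-reflexive (cong suc VN≡l))) (detourVertices-at id s D.word (D.fixing ≤-refl l<N)))
    }
    where
    module D = Detoured D
    c = detourColour l
    open Detour N l c (Colour⇒Avoids (detourColour-colour l)) (detourColour-avoids l)

    count-c : count c D.word ≡ 2 * s
    count-c = trans (D.counts c) (trans (cong₂ _+_ (C.rainbow c (detourColour-colour l))
                                                   (cong (λ x → s * (2 * x)) (count-spokes-avoiding l (Colour⇒Avoids (detourColour-colour l)))))
                                        (trans (cong (2 * s +_) (*-zeroʳ s)) (+-identityʳ _)))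

    s<count : s < count c D.word
    s<count = subst (s <_) (sym count-c) (m<m+n s (≤-trans 1≤s (≤-reflexive (sym (+-identityʳ s)))))

    not-at-l : ∀ {V : Fun} → V N ≡ N ⊎ V N < l → V N ≢ l
    not-at-l (inj₁ VN≡N) VN≡l = <⇒≢ l<N (trans (sym VN≡l) VN≡N)
    not-at-l (inj₂ VN<l) VN≡l = <⇒≢ VN<l VN≡l

    home-resp : (λ V → V N ≡ N ⊎ V N < suc l) Respects _≗_
    home-resp V≗W = Sum.map (trans (sym (V≗W N))) (subst (_< suc l) (V≗W N))

    counts : ∀ γ → count γ (insertDetours s D.word) ≡ count γ C.word + s * (2 * count γ (spokes (suc l)))
    counts γ = begin
      count γ (insertDetours s D.word)                                         ≡⟨ count-insertDetours γ s D.word (<⇒≤ s<count) ⟩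
      count γ D.word + s * (2 * count γ [ σ ])                                 ≡⟨ cong (_+ s * (2 * count γ [ σ ])) (D.counts γ) ⟩
      count γ C.word + s * (2 * count γ (spokes l)) + s * (2 * count γ [ σ ])  ≡⟨ collect (count γ C.word) s (count γ [ σ ]) _ ⟩
      count γ C.word + s * (2 * (count γ [ σ ] + count γ (spokes l)))          ≡⟨ cong (λ x → count γ C.word + s * (2 * x)) (count-∷ γ σ (spokes l)) ⟨
      count γ C.word + s * (2 * count γ (spokes (suc l)))                      ∎
      where
      open ≡-Reasoning
      collect : ∀ x s a b → x + s * (2 * b) + s * (2 * a) ≡ x + s * (2 * (a + b))
      collect = solve-∀

  detoured : ∀ {l} → l ≤ N → Detoured l
  detoured {zero}  _     = detoured₀
  detoured {suc l} 1+l≤N = detoured-step 1+l≤N (detoured (<⇒≤ 1+l≤N))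

  extended : RainbowWord (suc N) (2 * s)
  extended = record
    { word = D.word ; colours = D.colours ; closed = D.closed ; distinct = D.distinct ; rainbow = rainbow }
    where
    module D = Detoured (detoured ≤-refl)
    C-avoids = All.map Colour⇒Avoids C.colours

    spoke-count : ∀ {a} → a < N → count (N , a) D.word ≡ 2 * s
    spoke-count {a} a<N = begin
      count (N , a) D.word                                        ≡⟨ D.counts (N , a) ⟩
      count (N , a) C.word + s * (2 * count (N , a) (spokes N))   ≡⟨ cong₂ (λ x y → x + s * (2 * y))
                                                                            (count-≡0-Avoids C.word C-avoids (λ (N≢N , _) → N≢N refl))
                                                                            (trans (count-resp-∼ (spokes N) ∼-flip) (count-spokes-hit N a<N ≤-refl)) ⟩
      s * 2                                                       ≡⟨ *-comm s 2 ⟩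
      2 * s                                                       ∎
      where open ≡-Reasoning

    rainbow : ∀ γ → Colour (suc N) γ → count γ D.word ≡ 2 * s
    rainbow (a , b) (a<k , b<k , a≢b) with a ≟ N | b ≟ N
    ... | yes refl | yes refl = contradiction refl a≢b
    ... | yes refl | no b≢N   = spoke-count (≤∧≢⇒< (≤-pred b<k) b≢N)
    ... | no a≢N   | yes refl = trans (count-resp-∼ D.word ∼-flip) (spoke-count (≤∧≢⇒< (≤-pred a<k) a≢N))
    ... | no a≢N   | no b≢N   = begin
      count (a , b) D.word                                        ≡⟨ D.counts (a , b) ⟩
      count (a , b) C.word + s * (2 * count (a , b) (spokes N))   ≡⟨ cong₂ (λ x y → x + s * (2 * y))
                                                                            (C.rainbow _ (≤∧≢⇒< (≤-pred a<k) a≢N , ≤∧≢⇒< (≤-pred b<k) b≢N , a≢b))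
                                                                            (count-spokes-avoiding N (a≢N , b≢N)) ⟩
      2 * s + s * 0                                               ≡⟨ cong (2 * s +_) (*-zeroʳ s) ⟩
      2 * s + 0                                                   ≡⟨ +-identityʳ _ ⟩
      2 * s                                                       ∎
      where open ≡-Reasoning

module Certificate (n r : ℕ) (w : List Pair) where

  -- The vertices fix every value ≥ n, so they are told apart by their values below n.
  key : Fun → List ℕ
  key f = map f (upTo n)

  Checks : Set
  Checks = All (Colour n) w
         × All (λ x → walk id w x ≡ x) (upTo n)
         × AllPairs (λ f g → key f ≢ key g) (visits id w)
         × All (λ a → All (λ b → a ≢ b → count (a , b) w ≡ r) (upTo n)) (upTo n)

  checks? : Dec Checks
  checks? = All.all? colour? w
      ×-dec All.all? (λ x → walk id w x ≟ x) (upTo n)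
      ×-dec AllPairs.allPairs? (λ f g → ¬? (≡-dec _≟_ (key f) (key g))) (visits id w)
      ×-dec All.all? (λ a → All.all? (λ b → ¬? (a ≟ b) →-dec (count (a , b) w ≟ r)) (upTo n)) (upTo n)
    where
    colour? : ∀ c → Dec (Colour n c)
    colour? (a , b) = (a <? n) ×-dec (b <? n) ×-dec ¬? (a ≟ b)

  certified : True checks? → RainbowWord n r
  certified passed = record
    { word     = w
    ; colours  = colours
    ; closed   = closed
    ; distinct = AllPairs.map (λ keys≢ f≗g → keys≢ (map-cong f≗g (upTo n))) keys-differ
    ; rainbow  = λ (a , b) (a<n , b<n , a≢b) → All.applyUpTo⁻ id n (All.applyUpTo⁻ id n counts a<n) b<n a≢b
    }
    where
    checks = toWitness passed
    colours = proj₁ checks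
    fixed = proj₁ (proj₂ checks)
    keys-differ = proj₁ (proj₂ (proj₂ checks))
    counts = proj₂ (proj₂ (proj₂ checks))

    closed : walk id w ≗ id
    closed x with x <? n
    ... | yes x<n = All.applyUpTo⁻ id n fixed x<n
    ... | no x≮n  = walk-keeps x id w (All.map (λ (a<n , b<n , _) → avoids a<n , avoids b<n) colours) refl
      where
      avoids : ∀ {a} → a < n → a ≢ x
      avoids a<n = <⇒≢ (<-≤-trans a<n (≮⇒≥ x≮n))

rainbow₂ : RainbowWord 2 2
rainbow₂ = Certificate.certified 2 2 ((0 , 1) ∷ (0 , 1) ∷ []) _

rainbow₃ : RainbowWord 3 2
rainbow₃ = Certificate.certified 3 2 ((0 , 1) ∷ (0 , 2) ∷ (1 , 2) ∷ (0 , 1) ∷ (0 , 2) ∷ (1 , 2) ∷ []) _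

rainbow₄ : RainbowWord 4 4
rainbow₄ = Certificate.certified 4 4
  ( (0 , 1) ∷ (0 , 2) ∷ (0 , 1) ∷ (0 , 2) ∷ (0 , 1) ∷ (0 , 3) ∷ (0 , 1) ∷ (0 , 3)
  ∷ (1 , 2) ∷ (1 , 3) ∷ (1 , 2) ∷ (0 , 3) ∷ (2 , 3) ∷ (0 , 3) ∷ (1 , 2) ∷ (1 , 3)
  ∷ (0 , 2) ∷ (2 , 3) ∷ (1 , 3) ∷ (1 , 2) ∷ (2 , 3) ∷ (0 , 2) ∷ (1 , 3) ∷ (2 , 3) ∷ []) _

toℕ-swapVal : ∀ {n} (i j x : Fin n) → toℕ (swapVal i j x) ≡ swap (toℕ i) (toℕ j) (toℕ x)
toℕ-swapVal i j x with x Fin.≟ i | x Fin.≟ j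
... | yes refl | _        = sym (swap-ˡ (toℕ x) (toℕ j))
... | no x≢i   | yes refl = sym (swap-ʳ (toℕ i) (toℕ x))
... | no x≢i   | no x≢j   = sym (swap-≢ (x≢i ∘ toℕ-injective) (x≢j ∘ toℕ-injective))

module _ {n : ℕ} where

  toTransposition : ∀ c → Colour n c → Transposition n
  toTransposition (a , b) (a<n , b<n , a≢b) with <-cmp a b
  ... | tri< a<b _ _ = fromℕ< a<n , fromℕ< b<n , subst₂ _<_ (sym (toℕ-fromℕ< a<n)) (sym (toℕ-fromℕ< b<n)) a<b
  ... | tri≈ _ a≡b _ = contradiction a≡b a≢b
  ... | tri> _ _ b<a = fromℕ< b<n , fromℕ< a<n , subst₂ _<_ (sym (toℕ-fromℕ< b<n)) (sym (toℕ-fromℕ< a<n)) b<a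

  SameTransposition : Transposition n → Transposition n → Set
  SameTransposition (i , j , _) (i′ , j′ , _) = i ≡ i′ × j ≡ j′

  ends : Transposition n → Pair
  ends (i , j , _) = toℕ i , toℕ j

  toℕ-swapVal-toTransposition : ∀ c (v : Colour n c) x →
    toℕ (swapVal (proj₁ (toTransposition c v)) (proj₁ (proj₂ (toTransposition c v))) x) ≡ ⟦ c ⟧ (toℕ x)
  toℕ-swapVal-toTransposition (a , b) (a<n , b<n , a≢b) x with <-cmp a b
  ... | tri< _ _ _ = trans (toℕ-swapVal _ _ x) (cong₂ (λ p q → swap p q (toℕ x)) (toℕ-fromℕ< a<n) (toℕ-fromℕ< b<n))
  ... | tri≈ _ a≡b _ = contradiction a≡b a≢b
  ... | tri> _ _ _ = trans (toℕ-swapVal _ _ x)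
                          (trans (cong₂ (λ p q → swap p q (toℕ x)) (toℕ-fromℕ< b<n) (toℕ-fromℕ< a<n)) (swap-comm b a (toℕ x)))

  sameTransposition⇔ : ∀ c (v : Colour n c) τ → SameTransposition (toTransposition c v) τ ⇔ ends τ ∼ c
  sameTransposition⇔ (a , b) (a<n , b<n , a≢b) (i , j , i<j) with <-cmp a b
  ... | tri< a<b _ _ = mk⇔ to from
    where
    to : fromℕ< a<n ≡ i × fromℕ< b<n ≡ j → (toℕ i , toℕ j) ∼ (a , b)
    to (refl , refl) = inj₁ (toℕ-fromℕ< a<n , toℕ-fromℕ< b<n)
    from : (toℕ i , toℕ j) ∼ (a , b) → fromℕ< a<n ≡ i × fromℕ< b<n ≡ j
    from (inj₁ (i≡a , j≡b)) = toℕ-injective (trans (toℕ-fromℕ< a<n) (sym i≡a)) , toℕ-injective (trans (toℕ-fromℕ< b<n) (sym j≡b))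
    from (inj₂ (i≡b , j≡a)) = contradiction (subst₂ _<_ i≡b j≡a i<j) (<-asym a<b)
  ... | tri≈ _ a≡b _ = contradiction a≡b a≢b
  ... | tri> _ _ b<a = mk⇔ to from
    where
    to : fromℕ< b<n ≡ i × fromℕ< a<n ≡ j → (toℕ i , toℕ j) ∼ (a , b)
    to (refl , refl) = inj₂ (toℕ-fromℕ< b<n , toℕ-fromℕ< a<n)
    from : (toℕ i , toℕ j) ∼ (a , b) → fromℕ< b<n ≡ i × fromℕ< a<n ≡ j
    from (inj₁ (i≡a , j≡b)) = contradiction (subst₂ _<_ i≡a j≡b i<j) (<-asym b<a)
    from (inj₂ (i≡b , j≡a)) = toℕ-injective (trans (toℕ-fromℕ< b<n) (sym i≡b)) , toℕ-injective (trans (toℕ-fromℕ< a<n) (sym j≡a))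

  colourAt : ∀ {w} → All (Colour n) w → Fin (length w) → Transposition n
  colourAt {c ∷ _} (v ∷ _)  zero    = toTransposition c v
  colourAt         (_ ∷ vs) (suc t) = colourAt vs t

  count-colourAt : ∀ {w} (vs : All (Colour n) w) τ →
                   length (filter (λ x → sameTransposition? x τ) (tabulate (colourAt vs))) ≡ count (ends τ) w
  count-colourAt []                τ = refl
  count-colourAt {c ∷ w} (v ∷ vs) τ with ends τ ∼? c
  ... | yes τ∼c = trans (cong length (filter-accept (λ x → sameTransposition? x τ) (Equivalence.from (sameTransposition⇔ c v τ) τ∼c)))
                        (cong suc (count-colourAt vs τ))
  ... | no τ≁c  = trans (cong length (filter-reject (λ x → sameTransposition? x τ) (τ≁c ∘ Equivalence.to (sameTransposition⇔ c v τ))))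
                        (count-colourAt vs τ)

length-filter-tabulate : ∀ {A : Set} {Q : A → Set} (Q? : ∀ x → Dec (Q x)) {m k} (h : Fin m → Fin k) (f : Fin k → A) →
                         length (filter (λ t → Q? (f t)) (tabulate h)) ≡ length (filter Q? (tabulate (f ∘ h)))
length-filter-tabulate Q? {zero}  h f = refl
length-filter-tabulate Q? {suc m} h f with does (Q? (f (h zero)))
... | true  = cong suc (length-filter-tabulate Q? (h ∘ suc) f)
... | false = length-filter-tabulate Q? (h ∘ suc) f

walk-take-suc : ∀ f w (t : Fin (length w)) → walk f (take (suc (toℕ t)) w) ≡ ⟦ lookup w t ⟧ ∘ walk f (take (toℕ t) w)
walk-take-suc f (c ∷ w) zero    = refl
walk-take-suc f (c ∷ w) (suc t) = walk-take-suc (⟦ c ⟧ ∘ f) w t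

All-visits-take : ∀ {P : Fun → Set} f w {i} → All P (visits f w) → i < length w → P (walk f (take i w))
All-visits-take f (c ∷ w) {zero}  (pf ∷ _)  _           = pf
All-visits-take f (c ∷ w) {suc i} (_ ∷ pfs) (s≤s i<|w|) = All-visits-take (⟦ c ⟧ ∘ f) w pfs i<|w|

Distinct-visits-take : ∀ f w {i j} → Distinct (visits f w) → i < j → j < length w → walk f (take i w) ≉ walk f (take j w)
Distinct-visits-take f (c ∷ w) {zero}  {suc j} (f≉ ∷ _) _          (s≤s j<|w|) = All-visits-take (⟦ c ⟧ ∘ f) w f≉ j<|w|
Distinct-visits-take f (c ∷ w) {suc i} {suc j} (_ ∷ distinct) (s≤s i<j) (s≤s j<|w|) =
  Distinct-visits-take (⟦ c ⟧ ∘ f) w distinct i<j j<|w|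

module _ {n : ℕ} where

  walk-< : ∀ {f} w → All (Colour n) w → (∀ {x} → x < n → f x < n) → ∀ {x} → x < n → walk f w x < n
  walk-< []            []                      f-< = f-<
  walk-< ((a , b) ∷ w) ((a<n , b<n , _) ∷ cs) f-< = walk-< w cs (swap-< a<n b<n ∘ f-<)

  toℕ-swapVal-colourAt : ∀ {w} (vs : All (Colour n) w) t x →
    toℕ (swapVal (proj₁ (colourAt vs t)) (proj₁ (proj₂ (colourAt vs t))) x) ≡ ⟦ lookup w t ⟧ (toℕ x)
  toℕ-swapVal-colourAt {c ∷ _} (v ∷ _)  zero    x = toℕ-swapVal-toTransposition c v x
  toℕ-swapVal-colourAt         (_ ∷ vs) (suc t) x = toℕ-swapVal-colourAt vs t x

  toPerm : (f : Fun) → Injective _≡_ _≡_ f → (∀ {x} → x < n → f x < n) → Perm n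
  toPerm f f-inj f-< = (λ p → fromℕ< (f-< (toℕ<n p))) ,
    λ e → toℕ-injective (f-inj (trans (sym (toℕ-fromℕ< _)) (trans (cong toℕ e) (toℕ-fromℕ< _))))

  colour₀₁ : 2 ≤ n → Colour n (0 , 1)
  colour₀₁ 2≤n = ≤-trans (s≤s z≤n) 2≤n , 2≤n , λ ()

  ends-colour : ∀ τ → Colour n (ends τ)
  ends-colour (i , j , i<j) = toℕ<n i , toℕ<n j , <⇒≢ i<j

  toRainbowCycle : ∀ {r} → 2 ≤ n → 2 ≤ r → (R : RainbowWord n r) →
                   Σ (RainbowCycle n r) λ C → suc (RainbowCycle.k' C) ≡ length (RainbowWord.word R)
  toRainbowCycle 2≤n 2≤r record { word = [] ; rainbow = rainbow } =
    contradiction (rainbow (0 , 1) (colour₀₁ 2≤n)) (<⇒≢ (≤-trans (s≤s z≤n) 2≤r))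
  toRainbowCycle 2≤n 2≤r record { word = c ∷ [] ; rainbow = rainbow } =
    contradiction (subst (_≤ 1) (rainbow (0 , 1) (colour₀₁ 2≤n)) (count-≤-length (0 , 1) (c ∷ []))) (<⇒≱ 2≤r)
  toRainbowCycle {r} 2≤n 2≤r
    record { word = w@(_ ∷ _ ∷ cs) ; colours = colours ; closed = closed ; distinct = distinct ; rainbow = rainbow } =
    record
      { k'       = suc (length cs)
      ; len≥2    = s≤s z≤n
      ; perm     = vertex-perm ∘ toℕ
      ; distinct = vertex-perm-injective _ _
      ; colour   = colourAt colours
      ; steps    = step
      ; rainbow  = λ τ → trans (length-filter-tabulate (λ x → sameTransposition? x τ) id (colourAt colours))
                                (trans (count-colourAt colours τ) (rainbow (ends τ) (ends-colour τ)))
      } , refl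
    where
    vertex : ℕ → Fun
    vertex i = walk id (take i w)

    vertex-perm : ℕ → Perm n
    vertex-perm i = toPerm (vertex i) (walk-injective (take i w) id) (walk-< (take i w) (All.take⁺ i colours) id)

    toℕ-vertex-perm : ∀ i p → toℕ (proj₁ (vertex-perm i) p) ≡ vertex i (toℕ p)
    toℕ-vertex-perm i p = toℕ-fromℕ< _

    vertex-fixes : ∀ i {x} → n ≤ x → vertex i x ≡ x
    vertex-fixes i n≤x = walk-keeps _ id (take i w)
      (All.take⁺ i (All.map (λ (a<n , b<n , _) → <⇒≢ (<-≤-trans a<n n≤x) , <⇒≢ (<-≤-trans b<n n≤x)) colours)) refl

    agree : ∀ i j → vertex-perm i ≡ vertex-perm j → vertex i ≗ vertex j
    agree i j e x with x <? n
    ... | yes x<n = begin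
      vertex i x                                    ≡⟨ cong (vertex i) (toℕ-fromℕ< x<n) ⟨
      vertex i (toℕ (fromℕ< x<n))                   ≡⟨ toℕ-vertex-perm i (fromℕ< x<n) ⟨
      toℕ (proj₁ (vertex-perm i) (fromℕ< x<n))      ≡⟨ cong (λ π → toℕ (proj₁ π (fromℕ< x<n))) e ⟩
      toℕ (proj₁ (vertex-perm j) (fromℕ< x<n))      ≡⟨ toℕ-vertex-perm j (fromℕ< x<n) ⟩
      vertex j (toℕ (fromℕ< x<n))                   ≡⟨ cong (vertex j) (toℕ-fromℕ< x<n) ⟩
      vertex j x                                    ∎
      where open ≡-Reasoning
    ... | no x≮n = trans (vertex-fixes i (≮⇒≥ x≮n)) (sym (vertex-fixes j (≮⇒≥ x≮n)))

    vertex-perm-injective : ∀ (t t′ : Fin (length w)) → vertex-perm (toℕ t) ≡ vertex-perm (toℕ t′) → t ≡ t′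
    vertex-perm-injective t t′ e with <-cmp (toℕ t) (toℕ t′)
    ... | tri< t<t′ _ _ = contradiction (agree (toℕ t) (toℕ t′) e) (Distinct-visits-take id w distinct t<t′ (toℕ<n t′))
    ... | tri≈ _ t≡t′ _ = toℕ-injective t≡t′
    ... | tri> _ _ t′<t = contradiction (agree (toℕ t′) (toℕ t) (sym e)) (Distinct-visits-take id w distinct t′<t (toℕ<n t))

    next-vertex : ∀ t → vertex (toℕ (nextIdx t)) ≗ ⟦ lookup w t ⟧ ∘ vertex (toℕ t)
    next-vertex t x with m≤n⇒m<n∨m≡n (toℕ<n t)
    ... | inj₁ 1+t<|w| = begin
      vertex (toℕ (nextIdx t)) x          ≡⟨ cong (λ i → vertex i x) (trans (toℕ-fromℕ< _) (m<n⇒m%n≡m 1+t<|w|)) ⟩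
      vertex (suc (toℕ t)) x              ≡⟨ cong (_$ x) (walk-take-suc id w t) ⟩
      ⟦ lookup w t ⟧ (vertex (toℕ t) x)   ∎
      where open ≡-Reasoning
    ... | inj₂ 1+t≡|w| = begin
      vertex (toℕ (nextIdx t)) x          ≡⟨ cong (λ i → vertex i x) (trans (toℕ-fromℕ< _) (trans (cong (_% length w) 1+t≡|w|) (n%n≡0 (length w)))) ⟩
      x                                   ≡⟨ closed x ⟨
      walk id w x                         ≡⟨ cong (λ v → walk id v x) (take-all (suc (toℕ t)) w (≤-reflexive (sym 1+t≡|w|))) ⟨
      vertex (suc (toℕ t)) x              ≡⟨ cong (_$ x) (walk-take-suc id w t) ⟩
      ⟦ lookup w t ⟧ (vertex (toℕ t) x)   ∎
      where open ≡-Reasoning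

    step : ∀ t → Step (colourAt colours t) (vertex-perm (toℕ t)) (vertex-perm (toℕ (nextIdx t)))
    step t p = toℕ-injective (trans (begin
      toℕ (proj₁ (vertex-perm (toℕ (nextIdx t))) p)          ≡⟨ toℕ-vertex-perm (toℕ (nextIdx t)) p ⟩
      vertex (toℕ (nextIdx t)) (toℕ p)                       ≡⟨ next-vertex t (toℕ p) ⟩
      ⟦ lookup w t ⟧ (vertex (toℕ t) (toℕ p))                ≡⟨ cong ⟦ lookup w t ⟧ (toℕ-vertex-perm (toℕ t) p) ⟨
      ⟦ lookup w t ⟧ (toℕ (proj₁ (vertex-perm (toℕ t)) p))   ∎) (sym (toℕ-swapVal-colourAt colours t (proj₁ (vertex-perm (toℕ t)) p))))
      where open ≡-Reasoning

hamiltonian : ∀ k → 2 ≤ k → Σ (RainbowWord k (2 * (k ∸ 2) !)) λ R → length (RainbowWord.word R) ≡ k !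
hamiltonian 1 (s≤s ())
hamiltonian 2 _ = rainbow₂ , refl
hamiltonian 3 _ = rainbow₃ , refl
hamiltonian 4 _ = rainbow₄ , refl
hamiltonian (suc (suc (suc (suc (suc n))))) _ with hamiltonian (4 + n) (s≤s (s≤s z≤n))
... | H , |H| = subst (λ r → Σ (RainbowWord (5 + n) r) λ R → length (RainbowWord.word R) ≡ (5 + n) !)
                      (rate n ((2 + n) !)) (proj₁ G , trans (proj₂ G) (cong ((5 + n) *_) |H|))
  where
  G = Gluing.glued n (≤-trans (1≤n! (2 + n)) (m≤m+n _ _)) H
  rate : ∀ n x → (3 + n) * (2 * x) ≡ 2 * ((3 + n) * x)
  rate = solve-∀

raise : ∀ {m n s} → 3 ≤ m → 1 ≤ s → m ≤′ n → RainbowWord m (2 * s) → RainbowWord n (2 * s)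
raise 3≤m 1≤s (≤′-reflexive refl) R = R
raise 3≤m 1≤s (≤′-step m≤′n)      R =
  Detours.extended (≤-trans 3≤m (≤′⇒≤ m≤′n)) 1≤s (raise 3≤m 1≤s m≤′n R)

rainbowWord : ∀ {m n} → 2 ≤ m → m ≤ n → RainbowWord n (2 * (m ∸ 2) !)
rainbowWord {1} (s≤s ()) _
rainbowWord {2} {1}                   _   (s≤s ())
rainbowWord {2} {2}                   _   _   = proj₁ (hamiltonian 2 ≤-refl)
-- detours need three symbols, and the 2-rainbow cycle on 3 symbols also has rate 2 · (2 ∸ 2)!
rainbowWord {2} {suc (suc (suc n))}   _   _   = raise ≤-refl ≤-refl (≤⇒≤′ (s≤s (s≤s (s≤s z≤n)))) rainbow₃
rainbowWord {m@(suc (suc (suc _)))}   2≤m m≤n =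
  raise (s≤s (s≤s (s≤s z≤n))) (1≤n! (m ∸ 2)) (≤⇒≤′ m≤n) (proj₁ (hamiltonian m 2≤m))

theorem2p2 : (n : ℕ) → 2 ≤ n →
    ((m : ℕ) → 2 ≤ m → m ≤ n → RainbowCycle n (2 * ((m ∸ 2) !)))
    × Σ (RainbowCycle n (2 * ((n ∸ 2) !))) (λ C → suc (RainbowCycle.k' C) ≡ n !)
theorem2p2 n 2≤n =
  (λ m 2≤m m≤n → proj₁ (toRainbowCycle 2≤n (2≤2*k! (m ∸ 2)) (rainbowWord 2≤m m≤n))) ,
  (proj₁ cycle , trans (proj₂ cycle) (proj₂ (hamiltonian n 2≤n)))
  where
  2≤2*k! : ∀ k → 2 ≤ 2 * k !
  2≤2*k! k = *-monoʳ-≤ 2 (1≤n! k)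
  cycle = toRainbowCycle 2≤n (2≤2*k! (n ∸ 2)) (proj₁ (hamiltonian n 2≤n))
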